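{- (i) $B^1_{312}(x) = \dfrac{x^3}{(1-x)^2}$. (ii) For all $d\ge 4$, with $\tau = d\,1\,2\ldots(d-1)$, $$B^1_{\tau}(x) = \frac{x^d}{(1-x)^3(1-x-x^2)^{d-4}}.$$
   Context: $S_n$ is the set of permutations of $\{1,\dots,n\}$ in one-line notation. An occurrence of a pattern $\sigma\in S_k$ in a permutation is a subsequence of length $k$ whose entries are in the same relative order as $\sigma$; a permutation avoids $\sigma$ if it has no occurrence. $\mathcal{P}_n(132)$ is the set of permutations in $S_n$ avoiding each of $132$, $2341$, $3241$ (equivalently, the two-stack sortable permutations avoiding $132$). For a pattern $\tau$, $B^1_\tau(x)=\sum_{n\ge 0}b_n x^n$ where $b_n$ is the number of permutations in $\mathcal{P}_n(132)$ containing exactly one occurrence of $\tau$. The pattern $d\,1\,2\ldots(d-1)$ is the permutation of length $d$ consisting of $d$ followed by $1,2,\dots,d-1$. -}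

module Defs where

open import Data.Bool using (Bool; true; false; _∧_; if_then_else_)
open import Data.Nat using (ℕ; zero; suc; _∸_; _<ᵇ_; _≡ᵇ_)
open import Data.List using (List; []; _∷_; map; filter; length; concatMap; upTo; foldr; zipWith)
open import Data.Integer using (ℤ; +_; -_) renaming (_+_ to _+ℤ_; _*_ to _*ℤ_)
open import Relation.Nullary.Decidable using (T?)
open import Data.Bool using (T)

words : ℕ → ℕ → List (List ℕ)
words n zero    = [] ∷ []
words n (suc k) = concatMap (λ w → map (λ a → suc a ∷ w) (upTo n)) (words n k)

allB : List Bool → Bool
allB []       = true
allB (x ∷ xs) = x ∧ allB xs

notIn : ℕ → List ℕ → Bool
notIn a xs = allB (map (λ c → if a ≡ᵇ c then false else true) xs)

distinct : List ℕ → Bool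
distinct []       = true
distinct (x ∷ xs) = notIn x xs ∧ distinct xs

S : ℕ → List (List ℕ)
S n = filter (λ w → T? (distinct w)) (words n n)

-- all subsequences of length k (one for each choice of k positions)
subseqs : ℕ → List ℕ → List (List ℕ)
subseqs zero    _        = [] ∷ []
subseqs (suc k) []       = []
subseqs (suc k) (x ∷ xs) = map (x ∷_) (subseqs k xs) ++' subseqs (suc k) xs
  where
  _++'_ : List (List ℕ) → List (List ℕ) → List (List ℕ)
  []       ++' ys = ys
  (a ∷ as) ++' ys = a ∷ (as ++' ys)

-- two sequences of distinct numbers are order-isomorphic
-- (same length, and for all i < j : a_i < a_j ⇔ b_i < b_j)
orderIso : List ℕ → List ℕ → Bool
orderIso []       []       = true
orderIso (x ∷ xs) (y ∷ ys) =
  allB (zipWith (λ x' y' → if x <ᵇ x' then y <ᵇ y' else (if y <ᵇ y' then false else true)) xs ys)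
  ∧ orderIso xs ys
orderIso _        _        = false

occ : List ℕ → List ℕ → ℕ
occ σ π = length (filter (λ s → T? (orderIso s σ)) (subseqs (length σ) π))

avoids : List ℕ → List ℕ → Bool
avoids σ π = occ σ π ≡ᵇ 0

P132 : ℕ → List (List ℕ)
P132 n = filter (λ π → T? (avoids (1 ∷ 3 ∷ 2 ∷ []) π
                          ∧ avoids (2 ∷ 3 ∷ 4 ∷ 1 ∷ []) π
                          ∧ avoids (3 ∷ 2 ∷ 4 ∷ 1 ∷ []) π)) (S n)

b : List ℕ → ℕ → ℕ
b τ n = length (filter (λ π → T? (occ τ π ≡ᵇ 1)) (P132 n))

tau : ℕ → List ℕ
tau d = d ∷ map suc (upTo (d ∸ 1))

-- Integer polynomials (coefficient lists, constant term first)
-- and products of a polynomial with a formal power series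

Poly : Set
Poly = List ℤ

coeff : Poly → ℕ → ℤ
coeff []       _       = + 0
coeff (c ∷ cs) zero    = c
coeff (c ∷ cs) (suc i) = coeff cs i

addP : Poly → Poly → Poly
addP []       qs       = qs
addP ps       []       = ps
addP (p ∷ ps) (q ∷ qs) = (p +ℤ q) ∷ addP ps qs

mulP : Poly → Poly → Poly
mulP []       qs = []
mulP (p ∷ ps) qs = addP (map (p *ℤ_) qs) (+ 0 ∷ mulP ps qs)

powP : Poly → ℕ → Poly
powP p zero    = + 1 ∷ []
powP p (suc k) = mulP p (powP p k)

-- coefficient of x^n in  D(x) · F(x)  where F(x) = Σ f n xⁿ
convCoeff : Poly → (ℕ → ℤ) → ℕ → ℤ
convCoeff D f n = go n
  where
  go : ℕ → ℤ
  go zero    = coeff D 0 *ℤ f n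
  go (suc k) = coeff D (suc k) *ℤ f (n ∸ suc k) +ℤ go k

monoCoeff : ℕ → ℕ → ℤ
monoCoeff d n = if n ≡ᵇ d then + 1 else + 0

-- the formal power series F equals x^d / D(x), i.e. D(x) · F(x) = x^d
-- (D always has constant term 1 below, so D is invertible in ℤ[[x]])
_≐x^_/_ : (ℕ → ℤ) → ℕ → Poly → Set
F ≐x^ d / D = ∀ n → convCoeff D F n ≡ monoCoeff d n
  where open import Relation.Binary.PropositionalEquality using (_≡_)

oneMinusX : Poly
oneMinusX = + 1 ∷ - (+ 1) ∷ []

oneMinusXMinusX² : Poly
oneMinusXMinusX² = + 1 ∷ - (+ 1) ∷ - (+ 1) ∷ []

B¹ : List ℕ → ℕ → ℤ
B¹ τ n = + (b τ n)

{-# OPTIONS --safe #-}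
module Submission where

-- If n ≥ 2, the maximum n of a member of 𝒫ₙ(132) is its first entry, its second entry (preceded by n − 1), or
-- (n ≥ 3) its last entry: an entry after it together with two entries before it would form 132, 2341 or 3241.
-- Conversely each of these three insertions of a new maximum stays in the class, which yields a duplicate-free
-- recursive enumeration of 𝒫ₙ(132).  An occurrence of τ = (k+1) 1 2 … k is an entry followed by an increasing
-- subsequence of k smaller entries, so under the three insertions the number of occurrences of τ and the numbers of
-- increasing subsequences of each length change in a simple way.  For the numbers Bₖ(n) of permutations with exactly
-- one occurrence of τ, Cₖ(n) of those avoiding τ with exactly one increasing subsequence of length k, and Eⱼ(n) of
-- those with exactly one increasing subsequence of length j and none longer, this gives
--   (1 − x) Bₖ = x Cₖ,  C₂ = x²/(1 − x),  Cₖ = x Eₖ₋₁ (k ≥ 3),  E₂ = x²/(1 − x)²,  (1 − x − x²) Eⱼ = x Eⱼ₋₁ (j ≥ 3),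
-- which solve to the stated rational functions.

open import Defs
import Algebra.Properties.CommutativeSemigroup as CSemigroupProperties
open import Data.Bool using (Bool; true; false; _∧_; not; if_then_else_; T)
open import Data.Bool.Properties using (∧-zeroʳ; ∧-identityʳ; ∧-assoc; T-∧)
open import Data.Integer as ℤ using (ℤ; -_; 0ℤ) renaming (_+_ to _+ℤ_; _*_ to _*ℤ_; _-_ to _-ℤ_)
import Data.Integer.Properties as ℤₚ
open import Data.Integer.Tactic.RingSolver using (solve-∀)
open import Data.List using (List; []; _∷_; [_]; map; filter; length; _++_; upTo; zipWith; concatMap; drop; iterate)
open import Data.List.Properties
  using (length-++; length-map; length-upTo; length-iterate; map-++; ++-identityʳ; ∷-injectiveˡ; ∷-injectiveʳ; ++-cancelʳ)
open import Data.List.Membership.Propositional using (_∈_; find)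
open import Data.List.Membership.Propositional.Properties
  using (∈-upTo⁻; ∈-upTo⁺; ∈-map⁺; ∈-map⁻; ∈-concatMap⁺; ∈-concatMap⁻; ∈-filter⁺; ∈-filter⁻
        ; ∈-++⁺ˡ; ∈-++⁺ʳ; ∈-++⁻; ∈-∃++)
open import Data.List.Relation.Binary.Permutation.Propositional using (_↭_; ↭-sym; ↭⇒↭ₛ)
open import Data.List.Relation.Binary.Permutation.Propositional.Properties
  using (↭-length; All-resp-↭) renaming (shift to ↭-shift)
import Data.List.Relation.Binary.Permutation.Setoid.Properties as ↭ₛ
open import Data.List.Relation.Binary.Sublist.Propositional using (_⊆_; []; _∷_; _∷ʳ_; ⊆-refl; minimum; from∈)
open import Data.List.Relation.Binary.Sublist.Propositional.Properties using (++⁺ˡ; ++⁺ʳ)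
open import Data.List.Relation.Unary.All as All using (All; []; _∷_)
import Data.List.Relation.Unary.All.Properties as All
open import Data.List.Relation.Unary.AllPairs as AllPairs using (AllPairs; []; _∷_)
import Data.List.Relation.Unary.AllPairs.Properties as AllPairs
open import Data.List.Relation.Unary.Any as Any using (Any; here; there)
import Data.List.Relation.Unary.Any.Properties as Any
open import Data.List.Relation.Unary.Unique.Propositional using (Unique)
import Data.List.Relation.Unary.Unique.Propositional.Properties as Unique
open import Data.Nat using (ℕ; zero; suc; _+_; _∸_; _≤_; _<_; z≤n; s≤s; z<s; s<s; _<ᵇ_; _≡ᵇ_; _≟_)
open import Data.Nat.Properties
open import Data.List.Membership.DecPropositional _≟_ using (_∈?_)
open import Data.Product using (_×_; _,_; proj₁; proj₂; ∃; ∃₂)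
open import Data.Sum using (inj₁; inj₂)
open import Data.Unit using (⊤; tt)
open import Function using (_∘_; id)
open import Function.Bundles using (Equivalence)
open import Relation.Binary.Definitions using (tri<; tri≈; tri>)
open import Relation.Binary.PropositionalEquality
  using (_≡_; _≢_; refl; sym; trans; cong; cong₂; subst; setoid; module ≡-Reasoning)
open import Relation.Nullary using (¬_; contradiction; yes; no)
open import Relation.Nullary.Decidable using (T?)

private
  variable
    A : Set

count : (A → Bool) → List A → ℕ
count p []       = 0
count p (x ∷ xs) = if p x then suc (count p xs) else count p xs

length-filter≡count : ∀ (p : A → Bool) xs → length (filter (T? ∘ p) xs) ≡ count p xs
length-filter≡count p []       = refl
length-filter≡count p (x ∷ xs) with p x
... | true  = cong suc (length-filter≡count p xs)
... | false = length-filter≡count p xs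

count-++ : ∀ (p : A → Bool) xs ys → count p (xs ++ ys) ≡ count p xs + count p ys
count-++ p []       ys = refl
count-++ p (x ∷ xs) ys with p x
... | true  = cong suc (count-++ p xs ys)
... | false = count-++ p xs ys

count-map : ∀ {B : Set} (p : B → Bool) (f : A → B) xs → count p (map f xs) ≡ count (p ∘ f) xs
count-map p f []       = refl
count-map p f (x ∷ xs) with p (f x)
... | true  = cong suc (count-map p f xs)
... | false = count-map p f xs

count-cong : ∀ {p q : A → Bool} {xs} → All (λ a → p a ≡ q a) xs → count p xs ≡ count q xs
count-cong []                  = refl
count-cong {q = q} {x ∷ _} (e ∷ es) rewrite e with q x
... | true  = cong suc (count-cong es)
... | false = count-cong es

count-none : ∀ {p : A → Bool} {xs} → All (λ a → p a ≡ false) xs → count p xs ≡ 0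
count-none []       = refl
count-none (e ∷ es) rewrite e = count-none es

count-mono : ∀ {p q : A → Bool} {xs} → All (λ a → p a ≡ true → q a ≡ true) xs → count p xs ≤ count q xs
count-mono [] = z≤n
count-mono {p = p} {q} {x ∷ _} (e ∷ es) with p x | q x
... | true  | true  = s≤s (count-mono es)
... | true  | false with () ← e refl
... | false | true  = m≤n⇒m≤1+n (count-mono es)
... | false | false = count-mono es

-- `subseqs` joins lists with a helper local to its where-block; the metavariable below is solved
-- by that helper, which is then shown to be _++_.
mutual
  subseqsAppend : ℕ → ℕ → List ℕ → List (List ℕ) → List (List ℕ) → List (List ℕ)
  subseqsAppend = _

  subseqs-suc-cons′ : ∀ k x xs → subseqs (suc k) (x ∷ xs)
                    ≡ subseqsAppend k x xs (map (x ∷_) (subseqs k xs)) (subseqs (suc k) xs)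
  subseqs-suc-cons′ k x xs with map {B = List ℕ} (x ∷_) (subseqs k xs) | subseqs (suc k) xs
  ... | _ | _ = refl

subseqsAppend≡++ : ∀ k x xs (ss ts : List (List ℕ)) → subseqsAppend k x xs ss ts ≡ ss ++ ts
subseqsAppend≡++ k x xs []       ts = refl
subseqsAppend≡++ k x xs (s ∷ ss) ts = cong (s ∷_) (subseqsAppend≡++ k x xs ss ts)

subseqs-suc-cons : ∀ k x xs → subseqs (suc k) (x ∷ xs) ≡ map (x ∷_) (subseqs k xs) ++ subseqs (suc k) xs
subseqs-suc-cons k x xs = trans (subseqs-suc-cons′ k x xs) (subseqsAppend≡++ k x xs (map (x ∷_) (subseqs k xs)) (subseqs (suc k) xs))

count-subseqs-cons : ∀ (p : List ℕ → Bool) k x xs →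
  count p (subseqs (suc k) (x ∷ xs)) ≡ count (p ∘ (x ∷_)) (subseqs k xs) + count p (subseqs (suc k) xs)
count-subseqs-cons p k x xs = begin
  count p (subseqs (suc k) (x ∷ xs))
    ≡⟨ cong (count p) (subseqs-suc-cons k x xs) ⟩
  count p (map (x ∷_) (subseqs k xs) ++ subseqs (suc k) xs)
    ≡⟨ count-++ p (map (x ∷_) (subseqs k xs)) _ ⟩
  count p (map (x ∷_) (subseqs k xs)) + count p (subseqs (suc k) xs)
    ≡⟨ cong (_+ count p (subseqs (suc k) xs)) (count-map p (x ∷_) (subseqs k xs)) ⟩
  count (p ∘ (x ∷_)) (subseqs k xs) + count p (subseqs (suc k) xs) ∎
  where open ≡-Reasoning

count-subseqs-snoc : ∀ (p : List ℕ → Bool) k xs y →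
  count p (subseqs (suc k) (xs ++ [ y ])) ≡ count (λ s → p (s ++ [ y ])) (subseqs k xs) + count p (subseqs (suc k) xs)
count-subseqs-snoc p zero    []       y = sym (+-identityʳ _)
count-subseqs-snoc p (suc k) []       y = refl
count-subseqs-snoc p zero    (x ∷ xs) y
  rewrite count-subseqs-cons p 0 x (xs ++ [ y ]) | count-subseqs-cons p 0 x xs | count-subseqs-snoc p 0 xs y
  = x∙yz≈y∙xz (count (p ∘ (x ∷_)) [ [] ]) (count (λ s → p (s ++ [ y ])) [ [] ]) (count p (subseqs 1 xs))
  where open CSemigroupProperties +-commutativeSemigroup using (x∙yz≈y∙xz)
count-subseqs-snoc p (suc k) (x ∷ xs) y
  rewrite count-subseqs-cons p (suc k) x (xs ++ [ y ]) | count-subseqs-cons p (suc k) x xs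
        | count-subseqs-cons (λ s → p (s ++ [ y ])) k x xs
        | count-subseqs-snoc (p ∘ (x ∷_)) k xs y | count-subseqs-snoc p (suc k) xs y
  = interchange (count (λ s → p (x ∷ s ++ [ y ])) (subseqs k xs)) _ _ _
  where open CSemigroupProperties +-commutativeSemigroup using (interchange)

All-subseqs : ∀ {P : ℕ → Set} k {xs} → All P xs → All (λ s → All P s × length s ≡ k) (subseqs k xs)
All-subseqs zero    _                = ([] , refl) ∷ []
All-subseqs (suc k) []               = []
All-subseqs (suc k) {x ∷ xs} (px ∷ pxs) rewrite subseqs-suc-cons k x xs =
  All.++⁺ (All.map⁺ (All.map (λ (ps , eq) → px ∷ ps , cong suc eq) (All-subseqs k pxs)))
          (All-subseqs (suc k) pxs)

count-subseqs-none : ∀ {P : ℕ → Set} (p : List ℕ → Bool) k {xs} → All P xs →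
  (∀ s → All P s → length s ≡ k → p s ≡ false) → count p (subseqs k xs) ≡ 0
count-subseqs-none p k pxs never = count-none (All.map (λ (ps , eq) → never _ ps eq) (All-subseqs k pxs))

count-subseqs-mono : ∀ {xs ys : List ℕ} → xs ⊆ ys → ∀ k (p : List ℕ → Bool) →
  count p (subseqs k xs) ≤ count p (subseqs k ys)
count-subseqs-mono []         k       p = ≤-refl
count-subseqs-mono (_ ∷ʳ _)   zero    p = ≤-refl
count-subseqs-mono (_ ∷ _)    zero    p = ≤-refl
count-subseqs-mono {xs} {y ∷ ys} (y ∷ʳ σ) (suc k) p = begin
  count p (subseqs (suc k) xs)  ≤⟨ count-subseqs-mono σ (suc k) p ⟩
  count p (subseqs (suc k) ys)  ≤⟨ m≤n+m _ _ ⟩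
  count (p ∘ (y ∷_)) (subseqs k ys) + count p (subseqs (suc k) ys)  ≡⟨ count-subseqs-cons p k y ys ⟨
  count p (subseqs (suc k) (y ∷ ys)) ∎
  where open ≤-Reasoning
count-subseqs-mono {x ∷ xs} {x ∷ ys} (refl ∷ σ) (suc k) p = begin
  count p (subseqs (suc k) (x ∷ xs))  ≡⟨ count-subseqs-cons p k x xs ⟩
  count (p ∘ (x ∷_)) (subseqs k xs) + count p (subseqs (suc k) xs)
    ≤⟨ +-mono-≤ (count-subseqs-mono σ k (p ∘ (x ∷_))) (count-subseqs-mono σ (suc k) p) ⟩
  count (p ∘ (x ∷_)) (subseqs k ys) + count p (subseqs (suc k) ys)  ≡⟨ count-subseqs-cons p k x ys ⟨
  count p (subseqs (suc k) (x ∷ ys)) ∎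
  where open ≤-Reasoning

count-subseqs-⊆ : ∀ {s xs : List ℕ} → s ⊆ xs → (p : List ℕ → Bool) → p s ≡ true →
  1 ≤ count p (subseqs (length s) xs)
count-subseqs-⊆ [] p ps rewrite ps = ≤-refl
count-subseqs-⊆ {s} (y ∷ʳ σ) p ps =
  ≤-trans (count-subseqs-⊆ σ p ps) (count-subseqs-mono (y ∷ʳ ⊆-refl) (length s) p)
count-subseqs-⊆ {x ∷ s} {x ∷ xs} (refl ∷ σ) p ps = begin
  1                                  ≤⟨ count-subseqs-⊆ σ (p ∘ (x ∷_)) ps ⟩
  count (p ∘ (x ∷_)) (subseqs (length s) xs)  ≤⟨ m≤m+n _ _ ⟩
  count (p ∘ (x ∷_)) (subseqs (length s) xs) + count p (subseqs (suc (length s)) xs)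
    ≡⟨ count-subseqs-cons p (length s) x xs ⟨
  count p (subseqs (suc (length s)) (x ∷ xs)) ∎
  where open ≤-Reasoning

<ᵇ-true : ∀ {m n} → m < n → (m <ᵇ n) ≡ true
<ᵇ-true {m} {n} m<n with m <ᵇ n | <⇒<ᵇ m<n
... | true | _ = refl

<ᵇ-false : ∀ {m n} → n ≤ m → (m <ᵇ n) ≡ false
<ᵇ-false {m} {n} n≤m with m <ᵇ n in eq
... | false = refl
... | true  = contradiction (<ᵇ⇒< m n (subst T (sym eq) tt)) (≤⇒≯ n≤m)

-- The comparison `orderIso` makes between the pairs (x , x′) and (y , y′).
sameOrder : ℕ → ℕ → ℕ → ℕ → Bool
sameOrder x y x′ y′ = if x <ᵇ x′ then y <ᵇ y′ else (if y <ᵇ y′ then false else true)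

isIncreasing : List ℕ → Bool
isIncreasing []       = true
isIncreasing (x ∷ xs) = allB (map (x <ᵇ_) xs) ∧ isIncreasing xs

atMost : ℕ → List ℕ → Bool
atMost x xs = allB (map (λ x′ → not (x <ᵇ x′)) xs)

allB-map-false : ∀ {f : ℕ → Bool} {xs} → Any (λ a → f a ≡ false) xs → allB (map f xs) ≡ false
allB-map-false (here fx≡false) rewrite fx≡false = refl
allB-map-false {f} {x ∷ _} (there any) = trans (cong (f x ∧_) (allB-map-false any)) (∧-zeroʳ (f x))

atMost-false : ∀ {x xs} → Any (x <_) xs → atMost x xs ≡ false
atMost-false = allB-map-false ∘ Any.map (λ x<y → cong not (<ᵇ-true x<y))

sameOrder-above : ∀ x {y} x′ {y′} → y < y′ → sameOrder x y x′ y′ ≡ (x <ᵇ x′)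
sameOrder-above x x′ y<y′ rewrite <ᵇ-true y<y′ with x <ᵇ x′
... | true  = refl
... | false = refl

sameOrder-below : ∀ x {y} x′ {y′} → y′ < y → sameOrder x y x′ y′ ≡ not (x <ᵇ x′)
sameOrder-below x x′ y′<y rewrite <ᵇ-false (<⇒≤ y′<y) with x <ᵇ x′
... | true  = refl
... | false = refl

sameOrder-rise : ∀ {x} y {x′} y′ → x < x′ → sameOrder x y x′ y′ ≡ (y <ᵇ y′)
sameOrder-rise y y′ x<x′ rewrite <ᵇ-true x<x′ = refl

sameOrder-fall : ∀ {x} y {x′} y′ → x′ < x → sameOrder x y x′ y′ ≡ not (y <ᵇ y′)
sameOrder-fall y y′ x′<x rewrite <ᵇ-false (<⇒≤ x′<x) with y <ᵇ y′
... | true  = refl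
... | false = refl

zip-sameOrder-above : ∀ x y {xs ys} → All (y <_) ys → length xs ≡ length ys →
  allB (zipWith (sameOrder x y) xs ys) ≡ allB (map (x <ᵇ_) xs)
zip-sameOrder-above x y {[]}      {[]}     _          _  = refl
zip-sameOrder-above x y {x′ ∷ xs} {_ ∷ ys} (y<y′ ∷ ps) eq =
  cong₂ _∧_ (sameOrder-above x x′ y<y′) (zip-sameOrder-above x y {xs} {ys} ps (suc-injective eq))

zip-sameOrder-below : ∀ x y {xs ys} → All (_< y) ys → length xs ≡ length ys →
  allB (zipWith (sameOrder x y) xs ys) ≡ atMost x xs
zip-sameOrder-below x y {[]}      {[]}     _          _  = refl
zip-sameOrder-below x y {x′ ∷ xs} {_ ∷ ys} (y′<y ∷ ps) eq =
  cong₂ _∧_ (sameOrder-below x x′ y′<y) (zip-sameOrder-below x y {xs} {ys} ps (suc-injective eq))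

zip-sameOrder-fall : ∀ x y {xs ys} → All (_< x) xs → length xs ≡ length ys →
  allB (zipWith (sameOrder x y) xs ys) ≡ atMost y ys
zip-sameOrder-fall x y {[]}     {[]}      _          _  = refl
zip-sameOrder-fall x y {_ ∷ xs} {y′ ∷ ys} (x′<x ∷ ps) eq =
  cong₂ _∧_ (sameOrder-fall y y′ x′<x) (zip-sameOrder-fall x y {xs} {ys} ps (suc-injective eq))

allB-zipWith-++ : ∀ (f : ℕ → ℕ → Bool) xs ys {xs′ ys′} → length xs ≡ length ys →
  allB (zipWith f (xs ++ xs′) (ys ++ ys′)) ≡ allB (zipWith f xs ys) ∧ allB (zipWith f xs′ ys′)
allB-zipWith-++ f []       []       _  = refl
allB-zipWith-++ f (x ∷ xs) (y ∷ ys) eq =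
  trans (cong (f x y ∧_) (allB-zipWith-++ f xs ys (suc-injective eq))) (sym (∧-assoc (f x y) _ _))

orderIso-increasing : ∀ {xs ys} → AllPairs _<_ ys → length xs ≡ length ys → orderIso xs ys ≡ isIncreasing xs
orderIso-increasing {[]}     {[]}     []           _  = refl
orderIso-increasing {x ∷ xs} {y ∷ ys} (y< ∷ ys↑) eq =
  cong₂ _∧_ (zip-sameOrder-above x y {xs} y< (suc-injective eq)) (orderIso-increasing {xs} ys↑ (suc-injective eq))

orderIso-dominated : ∀ {u s σ₁ σ} w ρ → length w ≡ length ρ → All (_< u) s → Any (σ₁ <_) σ →
  length s ≡ length σ → orderIso (u ∷ w ++ s) (σ₁ ∷ ρ ++ σ) ≡ false
orderIso-dominated {u} {s} {σ₁} {σ} w ρ eqw s<u any eq = cong (_∧ _) (begin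
  allB (zipWith (sameOrder u σ₁) (w ++ s) (ρ ++ σ))
    ≡⟨ allB-zipWith-++ (sameOrder u σ₁) w ρ eqw ⟩
  allB (zipWith (sameOrder u σ₁) w ρ) ∧ allB (zipWith (sameOrder u σ₁) s σ)
    ≡⟨ cong (allB (zipWith (sameOrder u σ₁) w ρ) ∧_) (zip-sameOrder-fall u σ₁ {s} {σ} s<u eq) ⟩
  allB (zipWith (sameOrder u σ₁) w ρ) ∧ atMost σ₁ σ
    ≡⟨ cong (allB (zipWith (sameOrder u σ₁) w ρ) ∧_) (atMost-false any) ⟩
  allB (zipWith (sameOrder u σ₁) w ρ) ∧ false
    ≡⟨ ∧-zeroʳ _ ⟩
  false ∎)
  where open ≡-Reasoning

orderIso-max-last : ∀ {t xs σₗ σ} → All (_< t) xs → Any (σₗ <_) σ → length xs ≡ length σ →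
  orderIso (xs ++ [ t ]) (σ ++ [ σₗ ]) ≡ false
orderIso-max-last {t} {x ∷ xs} {σₗ} {y ∷ σ} (x<t ∷ _) (here σₗ<y) eq = cong (_∧ _) (begin
  allB (zipWith (sameOrder x y) (xs ++ [ t ]) (σ ++ [ σₗ ]))
    ≡⟨ allB-zipWith-++ (sameOrder x y) xs σ (suc-injective eq) ⟩
  allB (zipWith (sameOrder x y) xs σ) ∧ (sameOrder x y t σₗ ∧ true)
    ≡⟨ cong (λ b → allB (zipWith (sameOrder x y) xs σ) ∧ (b ∧ true))
            (trans (sameOrder-rise y σₗ x<t) (<ᵇ-false (<⇒≤ σₗ<y))) ⟩
  allB (zipWith (sameOrder x y) xs σ) ∧ false
    ≡⟨ ∧-zeroʳ _ ⟩
  false ∎)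
  where open ≡-Reasoning
orderIso-max-last {t} {x ∷ xs} {σₗ} {y ∷ σ} (_ ∷ xs<t) (there any) eq =
  trans (cong (allB (zipWith (sameOrder x y) (xs ++ [ t ]) (σ ++ [ σₗ ])) ∧_) (orderIso-max-last xs<t any (suc-injective eq)))
        (∧-zeroʳ _)

occ≡count : ∀ σ π → occ σ π ≡ count (λ s → orderIso s σ) (subseqs (length σ) π)
occ≡count σ π = length-filter≡count (λ s → orderIso s σ) (subseqs (length σ) π)

occ-cons : ∀ σ₁ σ x xs →
  occ (σ₁ ∷ σ) (x ∷ xs) ≡ count (λ s → orderIso (x ∷ s) (σ₁ ∷ σ)) (subseqs (length σ) xs) + occ (σ₁ ∷ σ) xs
occ-cons σ₁ σ x xs = begin
  occ (σ₁ ∷ σ) (x ∷ xs)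
    ≡⟨ occ≡count (σ₁ ∷ σ) (x ∷ xs) ⟩
  count (λ s → orderIso s (σ₁ ∷ σ)) (subseqs (suc (length σ)) (x ∷ xs))
    ≡⟨ count-subseqs-cons (λ s → orderIso s (σ₁ ∷ σ)) (length σ) x xs ⟩
  count (λ s → orderIso (x ∷ s) (σ₁ ∷ σ)) (subseqs (length σ) xs)
    + count (λ s → orderIso s (σ₁ ∷ σ)) (subseqs (suc (length σ)) xs)
    ≡⟨ cong (count (λ s → orderIso (x ∷ s) (σ₁ ∷ σ)) (subseqs (length σ) xs) +_) (occ≡count (σ₁ ∷ σ) xs) ⟨
  count (λ s → orderIso (x ∷ s) (σ₁ ∷ σ)) (subseqs (length σ) xs) + occ (σ₁ ∷ σ) xs ∎
  where open ≡-Reasoning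

occ-snoc : ∀ σ₁ σ xs y →
  occ (σ₁ ∷ σ) (xs ++ [ y ])
    ≡ count (λ s → orderIso (s ++ [ y ]) (σ₁ ∷ σ)) (subseqs (length σ) xs) + occ (σ₁ ∷ σ) xs
occ-snoc σ₁ σ xs y = begin
  occ (σ₁ ∷ σ) (xs ++ [ y ])
    ≡⟨ occ≡count (σ₁ ∷ σ) (xs ++ [ y ]) ⟩
  count (λ s → orderIso s (σ₁ ∷ σ)) (subseqs (suc (length σ)) (xs ++ [ y ]))
    ≡⟨ count-subseqs-snoc (λ s → orderIso s (σ₁ ∷ σ)) (length σ) xs y ⟩
  count (λ s → orderIso (s ++ [ y ]) (σ₁ ∷ σ)) (subseqs (length σ) xs)
    + count (λ s → orderIso s (σ₁ ∷ σ)) (subseqs (suc (length σ)) xs)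
    ≡⟨ cong (count (λ s → orderIso (s ++ [ y ]) (σ₁ ∷ σ)) (subseqs (length σ) xs) +_) (occ≡count (σ₁ ∷ σ) xs) ⟨
  count (λ s → orderIso (s ++ [ y ]) (σ₁ ∷ σ)) (subseqs (length σ) xs) + occ (σ₁ ∷ σ) xs ∎
  where open ≡-Reasoning

occ-max-head : ∀ {t xs σ₁ σ} → All (_< t) xs → Any (σ₁ <_) σ → occ (σ₁ ∷ σ) (t ∷ xs) ≡ occ (σ₁ ∷ σ) xs
occ-max-head {t} {xs} {σ₁} {σ} xs<t any = trans (occ-cons σ₁ σ t xs) (cong (_+ occ (σ₁ ∷ σ) xs)
  (count-subseqs-none _ (length σ) xs<t (λ s s<t eq → orderIso-dominated [] [] refl s<t any eq)))

occ-max-second : ∀ {u t xs σ₁ σ₂ σ} → u < t → All (_< u) xs → Any (σ₁ <_) σ →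
  occ (σ₁ ∷ σ₂ ∷ σ) (u ∷ t ∷ xs) ≡ occ (σ₁ ∷ σ₂ ∷ σ) xs
occ-max-second {u} {t} {xs} {σ₁} {σ₂} {σ} u<t xs<u any = begin
  occ τ (u ∷ t ∷ xs)
    ≡⟨ occ-cons σ₁ (σ₂ ∷ σ) u (t ∷ xs) ⟩
  count (λ s → orderIso (u ∷ s) τ) (subseqs (suc (length σ)) (t ∷ xs)) + occ τ (t ∷ xs)
    ≡⟨ cong₂ _+_ (count-subseqs-cons (λ s → orderIso (u ∷ s) τ) (length σ) t xs)
                 (occ-max-head (All.map (λ x<u → <-trans x<u u<t) xs<u) (there any)) ⟩
  (count (λ s → orderIso (u ∷ t ∷ s) τ) (subseqs (length σ) xs)
     + count (λ s → orderIso (u ∷ s) τ) (subseqs (suc (length σ)) xs)) + occ τ xs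
    ≡⟨ cong (_+ occ τ xs) (cong₂ _+_
         (count-subseqs-none _ (length σ) xs<u (λ s s<u eq → orderIso-dominated [ t ] [ σ₂ ] refl s<u any eq))
         (count-subseqs-none _ (suc (length σ)) xs<u (λ s s<u eq → orderIso-dominated [] [] refl s<u (there any) eq))) ⟩
  occ τ xs ∎
  where
  τ = σ₁ ∷ σ₂ ∷ σ
  open ≡-Reasoning

occ-max-last : ∀ {t xs σₗ σ₁ σ} → All (_< t) xs → Any (σₗ <_) (σ₁ ∷ σ) →
  occ (σ₁ ∷ σ ++ [ σₗ ]) (xs ++ [ t ]) ≡ occ (σ₁ ∷ σ ++ [ σₗ ]) xs
occ-max-last {t} {xs} {σₗ} {σ₁} {σ} xs<t any =
  trans (occ-snoc σ₁ (σ ++ [ σₗ ]) xs t) (cong (_+ occ (σ₁ ∷ σ ++ [ σₗ ]) xs) (count-subseqs-none _ (length (σ ++ [ σₗ ])) xs<t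
    (λ s s<t eq → orderIso-max-last s<t any (trans eq (trans (length-++ σ) (+-comm (length σ) 1))))))

record IsPermutation (n : ℕ) (π : List ℕ) : Set where
  constructor perm
  field
    length≡ : length π ≡ n
    bounded : All (λ a → 1 ≤ a × a ≤ n) π
    unique  : Unique π

extensions : ℕ → List ℕ → List (List ℕ)
extensions n w = map (λ a → suc a ∷ w) (upTo n)

∈-words⁺ : ∀ n {π} → All (λ a → 1 ≤ a × a ≤ n) π → π ∈ words n (length π)
∈-words⁺ n {[]}        []                 = here refl
∈-words⁺ n {suc a ∷ π} ((_ , a<n) ∷ bnds) =
  ∈-concatMap⁺ (extensions n) (Any.map (λ { refl → ∈-map⁺ (λ a → suc a ∷ π) (∈-upTo⁺ a<n) }) (∈-words⁺ n bnds))

∈-words⁻ : ∀ n k {π} → π ∈ words n k → length π ≡ k × All (λ a → 1 ≤ a × a ≤ n) π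
∈-words⁻ n zero    (here refl) = refl , []
∈-words⁻ n (suc k) π∈
  with w , w∈ , π∈ext ← find (∈-concatMap⁻ (extensions n) {words n k} π∈)
  with a , a∈ , refl ← ∈-map⁻ (λ a → suc a ∷ w) π∈ext
  with len , bnds ← ∈-words⁻ n k w∈
  = cong suc len , (s≤s z≤n , ∈-upTo⁻ a∈) ∷ bnds

words-unique : ∀ n k → Unique (words n k)
words-unique n zero    = [] ∷ []
words-unique n (suc k) = concatMap-unique (words n k) (words-unique n k)
  where
  tail∈extensions : ∀ {w v} → v ∈ extensions n w → drop 1 v ≡ w
  tail∈extensions {w} v∈ with _ , _ , refl ← ∈-map⁻ (λ a → suc a ∷ w) v∈ = refl

  concatMap-unique : ∀ ws → Unique ws → Unique (concatMap (extensions n) ws)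
  concatMap-unique []       _          = []
  concatMap-unique (w ∷ ws) (w∉ ∷ ws!) =
    Unique.++⁺ (Unique.map⁺ (λ { refl → refl }) (Unique.upTo⁺ n)) (concatMap-unique ws ws!) disjoint
    where
    disjoint : ∀ {v} → ¬ (v ∈ extensions n w × v ∈ concatMap (extensions n) ws)
    disjoint (v∈w , v∈ws) with w′ , w′∈ , v∈w′ ← find (∈-concatMap⁻ (extensions n) {ws} v∈ws) =
      All.lookup w∉ w′∈ (trans (sym (tail∈extensions v∈w)) (tail∈extensions v∈w′))

T-notIn⁻ : ∀ a xs → T (notIn a xs) → All (a ≢_) xs
T-notIn⁻ a []       _ = []
T-notIn⁻ a (c ∷ cs) t with a ≡ᵇ c in eq
... | false = (λ { refl → subst T eq (≡⇒≡ᵇ a a refl) }) ∷ T-notIn⁻ a cs t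

T-notIn⁺ : ∀ a xs → All (a ≢_) xs → T (notIn a xs)
T-notIn⁺ a []       _          = _
T-notIn⁺ a (c ∷ cs) (a≢c ∷ ne) with a ≡ᵇ c in eq
... | false = T-notIn⁺ a cs ne
... | true  = contradiction (≡ᵇ⇒≡ a c (subst T (sym eq) _)) a≢c

T-distinct⁻ : ∀ π → T (distinct π) → Unique π
T-distinct⁻ []       _ = []
T-distinct⁻ (x ∷ xs) t with tx , txs ← Equivalence.to T-∧ t = T-notIn⁻ x xs tx ∷ T-distinct⁻ xs txs

T-distinct⁺ : ∀ π → Unique π → T (distinct π)
T-distinct⁺ []       _          = _
T-distinct⁺ (x ∷ xs) (x∉ ∷ xs!) = Equivalence.from T-∧ (T-notIn⁺ x xs x∉ , T-distinct⁺ xs xs!)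

∈-S⁻ : ∀ n {π} → π ∈ S n → IsPermutation n π
∈-S⁻ n {π} π∈
  with π∈words , t ← ∈-filter⁻ (T? ∘ distinct) {xs = words n n} π∈
  with len , bnds ← ∈-words⁻ n n π∈words
  = perm len bnds (T-distinct⁻ π t)

∈-S⁺ : ∀ n {π} → IsPermutation n π → π ∈ S n
∈-S⁺ n {π} (perm refl bnds π!) = ∈-filter⁺ (T? ∘ distinct) (∈-words⁺ n bnds) (T-distinct⁺ π π!)

S-unique : ∀ n → Unique (S n)
S-unique n = Unique.filter⁺ (T? ∘ distinct) (words-unique n n)

unique-length-≤ : ∀ {A : Set} {xs ys : List A} → Unique xs → (∀ {z} → z ∈ xs → z ∈ ys) → length xs ≤ length ys
unique-length-≤ {xs = []}               _          _   = z≤n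
unique-length-≤ {xs = x ∷ xs} {ys} (x∉ ∷ xs!) xs⊆ with ys₁ , ys₂ , refl ← ∈-∃++ (xs⊆ (here refl)) = begin
  suc (length xs)              ≤⟨ s≤s (unique-length-≤ xs! xs⊆ys₁++ys₂) ⟩
  suc (length (ys₁ ++ ys₂))    ≡⟨ cong suc (length-++ ys₁) ⟩
  suc (length ys₁ + length ys₂) ≡⟨ +-suc (length ys₁) (length ys₂) ⟨
  length ys₁ + length (x ∷ ys₂) ≡⟨ length-++ ys₁ ⟨
  length (ys₁ ++ x ∷ ys₂)      ∎
  where
  open ≤-Reasoning
  xs⊆ys₁++ys₂ : ∀ {z} → z ∈ xs → z ∈ ys₁ ++ ys₂
  xs⊆ys₁++ys₂ z∈ with ∈-++⁻ ys₁ (xs⊆ (there z∈))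
  ... | inj₁ z∈ys₁         = ∈-++⁺ˡ z∈ys₁
  ... | inj₂ (here refl)   = contradiction refl (All.lookup x∉ z∈)
  ... | inj₂ (there z∈ys₂) = ∈-++⁺ʳ ys₁ z∈ys₂

∈-iterate-suc : ∀ a k {z} → a ≤ z → z < a + k → z ∈ iterate suc a k
∈-iterate-suc a zero    a≤z z<a+0 = contradiction (≤-trans z<a+0 (≤-reflexive (+-identityʳ a))) (≤⇒≯ a≤z)
∈-iterate-suc a (suc k) {z} a≤z z<a+k with a ≟ z
... | yes refl = here refl
... | no  a≢z  = there (∈-iterate-suc (suc a) k (≤∧≢⇒< a≤z a≢z) (≤-trans z<a+k (≤-reflexive (+-suc a k))))

-- Pigeonhole: otherwise π injects into the n − 1 other values of [1, n].
IsPermutation-∈ : ∀ {n π v} → IsPermutation n π → 1 ≤ v → v ≤ n → v ∈ π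
IsPermutation-∈ {suc n} {π} {suc v} (perm len bnds π!) _ (s≤s v≤n) with suc v ∈? π
... | yes v∈ = v∈
... | no  v∉ = contradiction (unique-length-≤ π! π⊆others) (<⇒≱ (begin-strict
  length others                        ≡⟨ length-++ (iterate suc 1 v) ⟩
  length (iterate suc 1 v) + length (iterate suc (suc (suc v)) (n ∸ v))
    ≡⟨ cong₂ _+_ (length-iterate suc 1 v) (length-iterate suc (suc (suc v)) (n ∸ v)) ⟩
  v + (n ∸ v)                          ≡⟨ m+[n∸m]≡n v≤n ⟩
  n                                    <⟨ n<1+n n ⟩
  suc n                                ≡⟨ len ⟨
  length π                             ∎))
  where
  open ≤-Reasoning
  others : List ℕ
  others = iterate suc 1 v ++ iterate suc (suc (suc v)) (n ∸ v)
  π⊆others : ∀ {z} → z ∈ π → z ∈ others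
  π⊆others {z} z∈ with All.lookup bnds z∈ | <-cmp z (suc v)
  ... | 1≤z , _   | tri< z<v _ _ = ∈-++⁺ˡ (∈-iterate-suc 1 v 1≤z z<v)
  ... | _         | tri≈ _ refl _ = contradiction z∈ v∉
  ... | _ , z≤1+n | tri> _ _ v<z = ∈-++⁺ʳ (iterate suc 1 v) (∈-iterate-suc (suc (suc v)) (n ∸ v) v<z
          (s≤s (≤-trans z≤1+n (s≤s (≤-reflexive (sym (m+[n∸m]≡n v≤n)))))))

IsPermutation-resp-↭ : ∀ {n π π′} → π ↭ π′ → IsPermutation n π → IsPermutation n π′
IsPermutation-resp-↭ π↭π′ (perm len bnds π!) =
  perm (trans (sym (↭-length π↭π′)) len) (All-resp-↭ π↭π′ bnds) (↭ₛ.Unique-resp-↭ (setoid ℕ) (↭⇒↭ₛ π↭π′) π!)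

IsPermutation-< : ∀ {n π} → IsPermutation n π → All (_< suc n) π
IsPermutation-< (perm _ bnds _) = All.map (λ (_ , a≤n) → s≤s a≤n) bnds

IsPermutation-cons-max : ∀ {n π} → IsPermutation n π → IsPermutation (suc n) (suc n ∷ π)
IsPermutation-cons-max {n} P@(perm len bnds π!) =
  perm (cong suc len)
       ((s≤s z≤n , ≤-refl) ∷ All.map (λ (1≤a , a≤n) → 1≤a , m≤n⇒m≤1+n a≤n) bnds)
       (All.map (λ a<1+n eq → <-irrefl (sym eq) a<1+n) (IsPermutation-< P) ∷ π!)

IsPermutation-uncons-max : ∀ {n π} → IsPermutation (suc n) (suc n ∷ π) → IsPermutation n π
IsPermutation-uncons-max (perm len (_ ∷ bnds) (n∉ ∷ π!)) =
  perm (suc-injective len)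
       (All.zipWith (λ ((1≤a , a≤1+n) , n≢a) → 1≤a , ≤-pred (≤∧≢⇒< a≤1+n (n≢a ∘ sym))) (bnds , n∉))
       π!

IsPermutation-insert-max : ∀ {n} xs ys → IsPermutation n (xs ++ ys) → IsPermutation (suc n) (xs ++ suc n ∷ ys)
IsPermutation-insert-max {n} xs ys = IsPermutation-resp-↭ (↭-sym (↭-shift (suc n) xs ys)) ∘ IsPermutation-cons-max

IsPermutation-remove-max : ∀ {n} xs ys → IsPermutation (suc n) (xs ++ suc n ∷ ys) → IsPermutation n (xs ++ ys)
IsPermutation-remove-max {n} xs ys = IsPermutation-uncons-max ∘ IsPermutation-resp-↭ (↭-shift (suc n) xs ys)

σ132 σ2341 σ3241 : List ℕ
σ132  = 1 ∷ 3 ∷ 2 ∷ []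
σ2341 = 2 ∷ 3 ∷ 4 ∷ 1 ∷ []
σ3241 = 3 ∷ 2 ∷ 4 ∷ 1 ∷ []

avoids𝒫 : List ℕ → Bool
avoids𝒫 π = avoids σ132 π ∧ avoids σ2341 π ∧ avoids σ3241 π

Avoids𝒫 : List ℕ → Set
Avoids𝒫 π = occ σ132 π ≡ 0 × occ σ2341 π ≡ 0 × occ σ3241 π ≡ 0

InP132 : ℕ → List ℕ → Set
InP132 n π = IsPermutation n π × Avoids𝒫 π

T-avoids⁻ : ∀ π → T (avoids𝒫 π) → Avoids𝒫 π
T-avoids⁻ π t with t₁ , t₂₃ ← Equivalence.to T-∧ t with t₂ , t₃ ← Equivalence.to T-∧ t₂₃ =
  ≡ᵇ⇒≡ _ 0 t₁ , ≡ᵇ⇒≡ _ 0 t₂ , ≡ᵇ⇒≡ _ 0 t₃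

T-avoids⁺ : ∀ π → Avoids𝒫 π → T (avoids𝒫 π)
T-avoids⁺ π (o₁ , o₂ , o₃) =
  Equivalence.from T-∧ (≡⇒≡ᵇ _ 0 o₁ , Equivalence.from T-∧ (≡⇒≡ᵇ _ 0 o₂ , ≡⇒≡ᵇ _ 0 o₃))

∈-P132⁻ : ∀ n {π} → π ∈ P132 n → InP132 n π
∈-P132⁻ n {π} π∈ with π∈S , t ← ∈-filter⁻ (T? ∘ avoids𝒫) {xs = S n} π∈
  = ∈-S⁻ n π∈S , T-avoids⁻ π t

∈-P132⁺ : ∀ n {π} → InP132 n π → π ∈ P132 n
∈-P132⁺ n {π} (P , A) = ∈-filter⁺ (T? ∘ avoids𝒫) (∈-S⁺ n P) (T-avoids⁺ π A)

P132-unique : ∀ n → Unique (P132 n)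
P132-unique n = Unique.filter⁺ (T? ∘ avoids𝒫) (S-unique n)

occ-mono : ∀ σ {π′ π} → π′ ⊆ π → occ σ π′ ≤ occ σ π
occ-mono σ {π′} {π} π′⊆π = begin
  occ σ π′                                                ≡⟨ occ≡count σ π′ ⟩
  count (λ s → orderIso s σ) (subseqs (length σ) π′)      ≤⟨ count-subseqs-mono π′⊆π (length σ) (λ s → orderIso s σ) ⟩
  count (λ s → orderIso s σ) (subseqs (length σ) π)       ≡⟨ occ≡count σ π ⟨
  occ σ π                                                 ∎
  where open ≤-Reasoning

occ≡0⇒¬orderIso : ∀ σ {s π} → occ σ π ≡ 0 → s ⊆ π → length s ≡ length σ → orderIso s σ ≢ true
occ≡0⇒¬orderIso σ {s} {π} o s⊆π len iso = <⇒≱ (count-subseqs-⊆ s⊆π (λ s → orderIso s σ) iso) (begin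
  count (λ s → orderIso s σ) (subseqs (length s) π)  ≡⟨ cong (λ k → count (λ s → orderIso s σ) (subseqs k π)) len ⟩
  count (λ s → orderIso s σ) (subseqs (length σ) π)  ≡⟨ occ≡count σ π ⟨
  occ σ π                                            ≡⟨ o ⟩
  0                                                  ∎)
  where open ≤-Reasoning

avoids-⊆ : ∀ {π′ π} → π′ ⊆ π → Avoids𝒫 π → Avoids𝒫 π′
avoids-⊆ {π′} {π} π′⊆π (o₁ , o₂ , o₃) = vanish σ132 o₁ , vanish σ2341 o₂ , vanish σ3241 o₃
  where
  vanish : ∀ σ → occ σ π ≡ 0 → occ σ π′ ≡ 0
  vanish σ o = n≤0⇒n≡0 (≤-trans (occ-mono σ π′⊆π) (≤-reflexive o))

avoids-cons-max : ∀ {t β} → All (_< t) β → Avoids𝒫 β → Avoids𝒫 (t ∷ β)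
avoids-cons-max β<t (o₁ , o₂ , o₃) =
  trans (occ-max-head β<t (here (s<s z<s))) o₁ ,
  trans (occ-max-head β<t (here (s<s (s<s z<s)))) o₂ ,
  trans (occ-max-head β<t (there (here (s<s (s<s (s<s z<s)))))) o₃

avoids-max-second : ∀ {u t β} → u < t → All (_< u) β → Avoids𝒫 β → Avoids𝒫 (u ∷ t ∷ β)
avoids-max-second u<t β<u (o₁ , o₂ , o₃) =
  trans (occ-max-second u<t β<u (here (s<s z<s))) o₁ ,
  trans (occ-max-second u<t β<u (here (s<s (s<s z<s)))) o₂ ,
  trans (occ-max-second u<t β<u (here (s<s (s<s (s<s z<s))))) o₃

avoids-snoc-max : ∀ {t α} → All (_< t) α → Avoids𝒫 α → Avoids𝒫 (α ++ [ t ])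
avoids-snoc-max α<t (o₁ , o₂ , o₃) =
  trans (occ-max-last {σ = 3 ∷ []} α<t (there (here (s<s (s<s z<s))))) o₁ ,
  trans (occ-max-last {σ = 3 ∷ 4 ∷ []} α<t (here (s<s z<s))) o₂ ,
  trans (occ-max-last {σ = 2 ∷ 4 ∷ []} α<t (here (s<s z<s))) o₃

InP132-cons-max : ∀ {n β} → InP132 n β → InP132 (suc n) (suc n ∷ β)
InP132-cons-max (P , A) = IsPermutation-cons-max P , avoids-cons-max (IsPermutation-< P) A

InP132-max-second : ∀ {n β} → InP132 n β → InP132 (suc (suc n)) (suc n ∷ suc (suc n) ∷ β)
InP132-max-second {n} {β} (P , A) =
  IsPermutation-insert-max [ suc n ] β (IsPermutation-cons-max P) , avoids-max-second (n<1+n (suc n)) (IsPermutation-< P) A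

InP132-snoc-max : ∀ {n α} → InP132 n α → InP132 (suc n) (α ++ [ suc n ])
InP132-snoc-max {n} {α} (P , A) =
  IsPermutation-insert-max α [] (subst (IsPermutation n) (sym (++-identityʳ α)) P) , avoids-snoc-max (IsPermutation-< P) A

InP132-uncons-max : ∀ {n β} → InP132 (suc n) (suc n ∷ β) → InP132 n β
InP132-uncons-max {n} {β} (P , A) = IsPermutation-uncons-max P , avoids-⊆ {β} (suc n ∷ʳ ⊆-refl) A

InP132-remove-second : ∀ {n β} → InP132 (suc (suc n)) (suc n ∷ suc (suc n) ∷ β) → InP132 n β
InP132-remove-second {n} {β} (P , A) =
  IsPermutation-uncons-max (IsPermutation-remove-max [ suc n ] β P) , avoids-⊆ {β} (suc n ∷ʳ suc (suc n) ∷ʳ ⊆-refl) A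

InP132-unsnoc-max : ∀ {n α} → InP132 (suc n) (α ++ [ suc n ]) → InP132 n α
InP132-unsnoc-max {n} {α} (P , A) =
  subst (IsPermutation n) (++-identityʳ α) (IsPermutation-remove-max α [] P) , avoids-⊆ {α} (++⁺ʳ [ suc n ] ⊆-refl) A

data MaxPosition (t : ℕ) : List ℕ → Set where
  first  : ∀ β → MaxPosition t (t ∷ β)
  second : ∀ a β → MaxPosition t (a ∷ t ∷ β)
  last   : ∀ x y α → MaxPosition t (x ∷ y ∷ α ++ [ t ])
  inside : ∀ x y α w β → MaxPosition t (x ∷ y ∷ α ++ t ∷ w ∷ β)

maxPosition : ∀ {t π} → t ∈ π → MaxPosition t π
maxPosition t∈ with ∈-∃++ t∈
... | []            , β     , refl = first β
... | a ∷ []        , β     , refl = second a β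
... | x ∷ y ∷ α     , []    , refl = last x y α
... | x ∷ y ∷ α     , w ∷ β , refl = inside x y α w β

is132 : ∀ {a b c} → a < c → c < b → orderIso (a ∷ b ∷ c ∷ []) σ132 ≡ true
is132 a<c c<b rewrite <ᵇ-true (<-trans a<c c<b) | <ᵇ-true a<c | <ᵇ-false (<⇒≤ c<b) = refl

is2341 : ∀ {x y t w} → x < y → y < t → w < x → orderIso (x ∷ y ∷ t ∷ w ∷ []) σ2341 ≡ true
is2341 x<y y<t w<x
  rewrite <ᵇ-true x<y | <ᵇ-true (<-trans x<y y<t) | <ᵇ-false (<⇒≤ w<x) | <ᵇ-true y<t
        | <ᵇ-false (<⇒≤ (<-trans w<x x<y)) | <ᵇ-false (<⇒≤ (<-trans (<-trans w<x x<y) y<t)) = refl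

is3241 : ∀ {x y t w} → y < x → x < t → w < y → orderIso (x ∷ y ∷ t ∷ w ∷ []) σ3241 ≡ true
is3241 y<x x<t w<y
  rewrite <ᵇ-false (<⇒≤ y<x) | <ᵇ-true x<t | <ᵇ-false (<⇒≤ (<-trans w<y y<x)) | <ᵇ-true (<-trans y<x x<t)
        | <ᵇ-false (<⇒≤ w<y) | <ᵇ-false (<⇒≤ (<-trans (<-trans w<y y<x) x<t)) = refl

InP132-max-second⇒pred : ∀ {m a β} → InP132 (suc (suc m)) (a ∷ suc (suc m) ∷ β) → a ≡ suc m
InP132-max-second⇒pred {m} {a} {β} (P@(perm _ ((_ , a≤2+m) ∷ _) ((a≢2+m ∷ _) ∷ _)) , o₁ , _) with a ≟ suc m
... | yes a≡1+m = a≡1+m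
... | no  a≢1+m with IsPermutation-∈ P (s≤s z≤n) (n≤1+n (suc m))
...   | here 1+m≡a              = contradiction (sym 1+m≡a) a≢1+m
...   | there (here 1+m≡2+m)    = contradiction 1+m≡2+m (<⇒≢ (n<1+n (suc m)))
...   | there (there 1+m∈β)     =
  contradiction (is132 a<1+m (n<1+n (suc m))) (occ≡0⇒¬orderIso σ132 o₁ (refl ∷ refl ∷ from∈ 1+m∈β) refl)
  where
  a<1+m : a < suc m
  a<1+m = ≤∧≢⇒< (≤-pred (≤∧≢⇒< a≤2+m a≢2+m)) a≢1+m

-- With x, y before the maximum t and w after it, comparing x, y and w yields an occurrence of 132, 2341 or 3241.
¬InP132-max-inside : ∀ {n x y α w β} → ¬ InP132 (suc n) (x ∷ y ∷ α ++ suc n ∷ w ∷ β)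
¬InP132-max-inside {n} {x} {y} {α} {w} {β} (P , o₁ , o₂ , o₃)
  with Q ← IsPermutation-remove-max (x ∷ y ∷ α) (w ∷ β) P
  with x<t ∷ y<t ∷ rest<t ← IsPermutation-< Q | x∉ ∷ y∉ ∷ _ ← IsPermutation.unique Q
  with <-cmp x w
... | tri< x<w _ _ = occ≡0⇒¬orderIso σ132 o₁ x-t-w refl (is132 x<w w<t)
  where
  w<t = All.lookup rest<t (∈-++⁺ʳ α (here refl))
  x-t-w = refl ∷ y ∷ʳ ++⁺ˡ α (refl ∷ refl ∷ minimum β)
... | tri≈ _ x≡w _ = All.lookup x∉ (there (∈-++⁺ʳ α (here refl))) x≡w
... | tri> _ _ w<x with <-cmp y w
...   | tri< y<w _ _ = occ≡0⇒¬orderIso σ132 o₁ y-t-w refl (is132 y<w w<t)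
  where
  w<t = All.lookup rest<t (∈-++⁺ʳ α (here refl))
  y-t-w = x ∷ʳ refl ∷ ++⁺ˡ α (refl ∷ refl ∷ minimum β)
...   | tri≈ _ y≡w _ = All.lookup y∉ (∈-++⁺ʳ α (here refl)) y≡w
...   | tri> _ _ w<y with <-cmp x y
...     | tri< x<y _ _ = occ≡0⇒¬orderIso σ2341 o₂ x-y-t-w refl (is2341 x<y y<t w<x)
  where x-y-t-w = refl ∷ refl ∷ ++⁺ˡ α (refl ∷ refl ∷ minimum β)
...     | tri≈ _ x≡y _ = All.lookup x∉ (here refl) x≡y
...     | tri> _ _ y<x = occ≡0⇒¬orderIso σ3241 o₃ x-y-t-w refl (is3241 y<x x<t w<y)
  where x-y-t-w = refl ∷ refl ∷ ++⁺ˡ α (refl ∷ refl ∷ minimum β)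

mutual
  𝒫 : ℕ → List (List ℕ)
  𝒫 zero    = [ [] ]
  𝒫 (suc n) = map (suc n ∷_) (𝒫 n) ++ 𝒫MaxSecond n ++ 𝒫MaxLast n

  𝒫MaxSecond : ℕ → List (List ℕ)
  𝒫MaxSecond zero    = []
  𝒫MaxSecond (suc n) = map (λ β → suc n ∷ suc (suc n) ∷ β) (𝒫 n)

  𝒫MaxLast : ℕ → List (List ℕ)
  𝒫MaxLast zero          = []
  𝒫MaxLast (suc zero)    = []
  𝒫MaxLast (suc (suc n)) = map (_++ [ suc (suc (suc n)) ]) (𝒫 (suc (suc n)))

mutual
  𝒫-sound : ∀ n → All (InP132 n) (𝒫 n)
  𝒫-sound zero    = (perm refl [] [] , refl , refl , refl) ∷ []
  𝒫-sound (suc n) =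
    All.++⁺ (All.map⁺ (All.map InP132-cons-max (𝒫-sound n))) (All.++⁺ (𝒫MaxSecond-sound n) (𝒫MaxLast-sound n))

  𝒫MaxSecond-sound : ∀ n → All (InP132 (suc n)) (𝒫MaxSecond n)
  𝒫MaxSecond-sound zero    = []
  𝒫MaxSecond-sound (suc n) = All.map⁺ (All.map InP132-max-second (𝒫-sound n))

  𝒫MaxLast-sound : ∀ n → All (InP132 (suc n)) (𝒫MaxLast n)
  𝒫MaxLast-sound zero          = []
  𝒫MaxLast-sound (suc zero)    = []
  𝒫MaxLast-sound (suc (suc n)) = All.map⁺ (All.map InP132-snoc-max (𝒫-sound (suc (suc n))))

∈-𝒫MaxLast : ∀ n {x y α} → InP132 (suc n) (x ∷ y ∷ α ++ [ suc n ]) → x ∷ y ∷ α ∈ 𝒫 n →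
              x ∷ y ∷ α ++ [ suc n ] ∈ 𝒫MaxLast n
∈-𝒫MaxLast (suc zero) {α = α} (perm len _ _ , _) _ =
  contradiction (suc-injective (suc-injective len)) (λ eq → 1+n≢0 (trans (+-comm 1 (length α)) (trans (sym (length-++ α)) eq)))
∈-𝒫MaxLast (suc (suc k)) _ α∈ = ∈-map⁺ (_++ [ suc (suc (suc k)) ]) α∈

mutual
  𝒫-complete : ∀ n {π} → InP132 n π → π ∈ 𝒫 n
  𝒫-complete zero    {[]} _ = here refl
  𝒫-complete (suc n) I     = 𝒫-complete-at (suc n) (maxPosition (IsPermutation-∈ (proj₁ I) (s≤s z≤n) ≤-refl)) I

  𝒫-complete-at : ∀ n {π} → MaxPosition n π → InP132 n π → π ∈ 𝒫 n
  𝒫-complete-at (suc zero)    (first [])       _                  = here refl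
  𝒫-complete-at (suc zero)    (first (_ ∷ _))  (perm () _ _ , _)
  𝒫-complete-at (suc zero)    (second _ _)     (perm () _ _ , _)
  𝒫-complete-at (suc zero)    (last _ _ _)     (perm () _ _ , _)
  𝒫-complete-at (suc (suc m)) (first β) I =
    ∈-++⁺ˡ (∈-map⁺ (suc (suc m) ∷_) (𝒫-complete (suc m) (InP132-uncons-max I)))
  𝒫-complete-at (suc (suc m)) (second a β) I with refl ← InP132-max-second⇒pred I =
    ∈-++⁺ʳ (map (suc (suc m) ∷_) (𝒫 (suc m)))
      (∈-++⁺ˡ (∈-map⁺ (λ β → suc m ∷ suc (suc m) ∷ β) (𝒫-complete m (InP132-remove-second I))))
  𝒫-complete-at (suc (suc m)) (last x y α) I =
    ∈-++⁺ʳ (map (suc (suc m) ∷_) (𝒫 (suc m))) (∈-++⁺ʳ (𝒫MaxSecond (suc m))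
      (∈-𝒫MaxLast (suc m) I (𝒫-complete (suc m) (InP132-unsnoc-max {α = x ∷ y ∷ α} I))))
  𝒫-complete-at (suc n) (inside x y α w β) I = contradiction I ¬InP132-max-inside

𝒫MaxSecond-prefix : ∀ n {v} → v ∈ 𝒫MaxSecond n → ∃ λ β → v ≡ n ∷ suc n ∷ β
𝒫MaxSecond-prefix (suc n) v∈ with β , _ , refl ← ∈-map⁻ (λ β → suc n ∷ suc (suc n) ∷ β) v∈ = β , refl

𝒫MaxLast-prefix : ∀ n {v} → v ∈ 𝒫MaxLast n → ∃₂ λ a b → ∃ λ ρ → v ≡ a ∷ b ∷ ρ × a ≤ n × b ≤ n
𝒫MaxLast-prefix (suc (suc n)) v∈
  with α , α∈ , refl ← ∈-map⁻ (_++ [ suc (suc (suc n)) ]) v∈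
  with a ∷ b ∷ ρ ← α | perm _ ((_ , a≤n) ∷ (_ , b≤n) ∷ _) _ , _ ← All.lookup (𝒫-sound (suc (suc n))) α∈
  = a , b , ρ ++ [ suc (suc (suc n)) ] , refl , a≤n , b≤n

mutual
  𝒫-unique : ∀ n → Unique (𝒫 n)
  𝒫-unique zero    = [] ∷ []
  𝒫-unique (suc n) =
    Unique.++⁺ (Unique.map⁺ ∷-injectiveʳ (𝒫-unique n))
               (Unique.++⁺ (𝒫MaxSecond-unique n) (𝒫MaxLast-unique n) second∩last) first∩rest
    where
    first∩rest : ∀ {v} → ¬ (v ∈ map (suc n ∷_) (𝒫 n) × v ∈ 𝒫MaxSecond n ++ 𝒫MaxLast n)
    first∩rest (v∈first , v∈rest) with _ , _ , refl ← ∈-map⁻ (suc n ∷_) v∈first | ∈-++⁻ (𝒫MaxSecond n) v∈rest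
    ... | inj₁ v∈second with _ , eq ← 𝒫MaxSecond-prefix n v∈second = <-irrefl (sym (∷-injectiveˡ eq)) (n<1+n n)
    ... | inj₂ v∈last with _ , _ , _ , eq , a≤n , _ ← 𝒫MaxLast-prefix n v∈last
      = <-irrefl (sym (∷-injectiveˡ eq)) (s≤s a≤n)
    second∩last : ∀ {v} → ¬ (v ∈ 𝒫MaxSecond n × v ∈ 𝒫MaxLast n)
    second∩last (v∈second , v∈last)
      with _ , refl ← 𝒫MaxSecond-prefix n v∈second
      with _ , _ , _ , eq , _ , b≤n ← 𝒫MaxLast-prefix n v∈last
      = <-irrefl (sym (∷-injectiveˡ (∷-injectiveʳ eq))) (s≤s b≤n)

  𝒫MaxSecond-unique : ∀ n → Unique (𝒫MaxSecond n)
  𝒫MaxSecond-unique zero    = []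
  𝒫MaxSecond-unique (suc n) = Unique.map⁺ (∷-injectiveʳ ∘ ∷-injectiveʳ) (𝒫-unique n)

  𝒫MaxLast-unique : ∀ n → Unique (𝒫MaxLast n)
  𝒫MaxLast-unique zero          = []
  𝒫MaxLast-unique (suc zero)    = []
  𝒫MaxLast-unique (suc (suc n)) = Unique.map⁺ (++-cancelʳ _ _ _) (𝒫-unique (suc (suc n)))

count-P132 : ∀ (p : List ℕ → Bool) n → length (filter (T? ∘ p) (P132 n)) ≡ count p (𝒫 n)
count-P132 p n =
  trans (≤-antisym (unique-length-≤ P132ₚ! P132ₚ⊆𝒫ₚ) (unique-length-≤ 𝒫ₚ! 𝒫ₚ⊆P132ₚ)) (length-filter≡count p (𝒫 n))
  where
  P132ₚ! = Unique.filter⁺ (T? ∘ p) (P132-unique n)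
  𝒫ₚ! = Unique.filter⁺ (T? ∘ p) (𝒫-unique n)
  P132ₚ⊆𝒫ₚ : ∀ {π} → π ∈ filter (T? ∘ p) (P132 n) → π ∈ filter (T? ∘ p) (𝒫 n)
  P132ₚ⊆𝒫ₚ π∈ with π∈P132 , t ← ∈-filter⁻ (T? ∘ p) {xs = P132 n} π∈ =
    ∈-filter⁺ (T? ∘ p) (𝒫-complete n (∈-P132⁻ n π∈P132)) t
  𝒫ₚ⊆P132ₚ : ∀ {π} → π ∈ filter (T? ∘ p) (𝒫 n) → π ∈ filter (T? ∘ p) (P132 n)
  𝒫ₚ⊆P132ₚ π∈ with π∈𝒫 , t ← ∈-filter⁻ (T? ∘ p) {xs = 𝒫 n} π∈ =
    ∈-filter⁺ (T? ∘ p) (∈-P132⁺ n (All.lookup (𝒫-sound n) π∈𝒫)) t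

allB-++ : ∀ xs ys → allB (xs ++ ys) ≡ allB xs ∧ allB ys
allB-++ []       ys = refl
allB-++ (x ∷ xs) ys = trans (cong (x ∧_) (allB-++ xs ys)) (sym (∧-assoc x _ _))

atMost-true : ∀ {t xs} → All (_< t) xs → atMost t xs ≡ true
atMost-true []            = refl
atMost-true (x<t ∷ xs<t) rewrite <ᵇ-false (<⇒≤ x<t) = atMost-true xs<t

isIncreasing-descent : ∀ {u a} w s → a < u → isIncreasing (u ∷ w ++ a ∷ s) ≡ false
isIncreasing-descent w s a<u = cong (_∧ _) (allB-map-false (Any.++⁺ʳ w (here (<ᵇ-false (<⇒≤ a<u)))))

isIncreasing-snoc-max : ∀ {t} xs → All (_< t) xs → isIncreasing (xs ++ [ t ]) ≡ isIncreasing xs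
isIncreasing-snoc-max         []       _            = refl
isIncreasing-snoc-max {t} (x ∷ xs) (x<t ∷ xs<t) = cong₂ _∧_ (begin
  allB (map (x <ᵇ_) (xs ++ [ t ]))                     ≡⟨ cong allB (map-++ (x <ᵇ_) xs [ t ]) ⟩
  allB (map (x <ᵇ_) xs ++ [ x <ᵇ t ])                  ≡⟨ allB-++ (map (x <ᵇ_) xs) [ x <ᵇ t ] ⟩
  allB (map (x <ᵇ_) xs) ∧ ((x <ᵇ t) ∧ true)
    ≡⟨ cong (λ b → allB (map (x <ᵇ_) xs) ∧ (b ∧ true)) (<ᵇ-true x<t) ⟩
  allB (map (x <ᵇ_) xs) ∧ true                         ≡⟨ ∧-identityʳ _ ⟩
  allB (map (x <ᵇ_) xs)                                ∎) (isIncreasing-snoc-max xs xs<t)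
  where open ≡-Reasoning

τ-tail : ℕ → List ℕ
τ-tail k = map suc (upTo k)

τ-tail-length : ∀ k → length (τ-tail k) ≡ k
τ-tail-length k = trans (length-map suc (upTo k)) (length-upTo k)

τ-tail-below : ∀ k → All (_< suc k) (τ-tail k)
τ-tail-below k = All.map⁺ (All.tabulate (λ i∈ → s≤s (∈-upTo⁻ i∈)))

τ-tail-increasing : ∀ k → AllPairs _<_ (τ-tail k)
τ-tail-increasing k = AllPairs.map⁺ (AllPairs.applyUpTo⁺₁ id k (λ i<j _ → s≤s i<j))

-- In `tau (suc k) = suc k ∷ τ-tail k` the first entry is the maximum and the rest increases.
orderIso-τ : ∀ k x s → length s ≡ k → orderIso (x ∷ s) (tau (suc k)) ≡ atMost x s ∧ isIncreasing s
orderIso-τ k x s len = cong₂ _∧_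
  (zip-sameOrder-below x (suc k) {s} (τ-tail-below k) eq)
  (orderIso-increasing {s} (τ-tail-increasing k) eq)
  where eq = trans len (sym (τ-tail-length k))

inc : ℕ → List ℕ → ℕ
inc j π = count isIncreasing (subseqs j π)

occτ : ℕ → List ℕ → ℕ
occτ k π = occ (tau (suc k)) π

subseqs-length : ∀ k xs → All (λ s → length s ≡ k) (subseqs k xs)
subseqs-length k xs = All.map proj₂ (All-subseqs {P = λ _ → ⊤} k (All.universal (λ _ → tt) xs))

occτ-cons : ∀ k x xs → occτ k (x ∷ xs) ≡ count (λ s → atMost x s ∧ isIncreasing s) (subseqs k xs) + occτ k xs
occτ-cons k x xs = begin
  occτ k (x ∷ xs)
    ≡⟨ occ-cons (suc k) (τ-tail k) x xs ⟩
  count (λ s → orderIso (x ∷ s) (tau (suc k))) (subseqs (length (τ-tail k)) xs) + occτ k xs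
    ≡⟨ cong (λ m → count (λ s → orderIso (x ∷ s) (tau (suc k))) (subseqs m xs) + occτ k xs) (τ-tail-length k) ⟩
  count (λ s → orderIso (x ∷ s) (tau (suc k))) (subseqs k xs) + occτ k xs
    ≡⟨ cong (_+ occτ k xs) (count-cong (All.map (λ {s} → orderIso-τ k x s) (subseqs-length k xs))) ⟩
  count (λ s → atMost x s ∧ isIncreasing s) (subseqs k xs) + occτ k xs ∎
  where open ≡-Reasoning

inc-cons : ∀ j x xs → inc (suc j) (x ∷ xs) ≡ count (isIncreasing ∘ (x ∷_)) (subseqs j xs) + inc (suc j) xs
inc-cons j = count-subseqs-cons isIncreasing j

inc-one : ∀ π → inc 1 π ≡ length π
inc-one []       = refl
inc-one (x ∷ xs) = trans (inc-cons 0 x xs) (cong suc (inc-one xs))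

inc-cons-max : ∀ j {t β} → All (_< t) β → inc (suc (suc j)) (t ∷ β) ≡ inc (suc (suc j)) β
inc-cons-max j {t} {β} β<t = trans (inc-cons (suc j) t β) (cong (_+ inc (suc (suc j)) β)
  (count-subseqs-none _ (suc j) β<t λ { (a ∷ s) (a<t ∷ _) _ → isIncreasing-descent [] s a<t }))

inc-max-second : ∀ j {u t β} → u < t → All (_< u) β → inc (suc (suc (suc j))) (u ∷ t ∷ β) ≡ inc (suc (suc (suc j))) β
inc-max-second j {u} {t} {β} u<t β<u = begin
  inc (3 + j) (u ∷ t ∷ β)
    ≡⟨ inc-cons (2 + j) u (t ∷ β) ⟩
  count (isIncreasing ∘ (u ∷_)) (subseqs (2 + j) (t ∷ β)) + inc (3 + j) (t ∷ β)
    ≡⟨ cong₂ _+_ (count-subseqs-cons (isIncreasing ∘ (u ∷_)) (suc j) t β) (inc-cons-max (suc j) β<t) ⟩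
  (count (λ s → isIncreasing (u ∷ t ∷ s)) (subseqs (1 + j) β) + count (isIncreasing ∘ (u ∷_)) (subseqs (2 + j) β))
    + inc (3 + j) β
    ≡⟨ cong (_+ inc (3 + j) β) (cong₂ _+_
         (count-subseqs-none _ (suc j) β<u λ { (a ∷ s) (a<u ∷ _) _ → isIncreasing-descent [ t ] s a<u })
         (count-subseqs-none _ (suc (suc j)) β<u λ { (a ∷ s) (a<u ∷ _) _ → isIncreasing-descent [] s a<u })) ⟩
  inc (3 + j) β ∎
  where
  open ≡-Reasoning
  β<t = All.map (λ a<u → <-trans a<u u<t) β<u

inc₂-max-second : ∀ {u t β} → u < t → All (_< u) β → inc 2 (u ∷ t ∷ β) ≡ suc (inc 2 β)
inc₂-max-second {u} {t} {β} u<t β<u = begin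
  inc 2 (u ∷ t ∷ β)
    ≡⟨ inc-cons 1 u (t ∷ β) ⟩
  count (isIncreasing ∘ (u ∷_)) (subseqs 1 (t ∷ β)) + inc 2 (t ∷ β)
    ≡⟨ cong₂ _+_ (count-subseqs-cons (isIncreasing ∘ (u ∷_)) 0 t β) (inc-cons-max 0 β<t) ⟩
  (count (λ s → isIncreasing (u ∷ t ∷ s)) [ [] ] + count (isIncreasing ∘ (u ∷_)) (subseqs 1 β)) + inc 2 β
    ≡⟨ cong (_+ inc 2 β) (cong₂ _+_ u-t-increasing
         (count-subseqs-none _ 1 β<u λ { (a ∷ s) (a<u ∷ _) _ → isIncreasing-descent [] s a<u })) ⟩
  suc (inc 2 β) ∎
  where
  open ≡-Reasoning
  β<t = All.map (λ a<u → <-trans a<u u<t) β<u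
  u-t-increasing : count (λ s → isIncreasing (u ∷ t ∷ s)) [ [] ] ≡ 1
  u-t-increasing rewrite <ᵇ-true u<t = refl

inc-snoc-max : ∀ j {t α} → All (_< t) α → inc (suc j) (α ++ [ t ]) ≡ inc j α + inc (suc j) α
inc-snoc-max j {t} {α} α<t = trans (count-subseqs-snoc isIncreasing j α t) (cong (_+ inc (suc j) α)
  (count-cong (All.map (λ {s} (s<t , _) → isIncreasing-snoc-max s s<t) (All-subseqs j α<t))))

occτ-cons-max : ∀ k {t β} → All (_< t) β → occτ k (t ∷ β) ≡ inc k β + occτ k β
occτ-cons-max k {t} {β} β<t = trans (occτ-cons k t β) (cong (_+ occτ k β)
  (count-cong (All.map (λ {s} (s<t , _) → cong (_∧ isIncreasing s) (atMost-true s<t)) (All-subseqs k β<t))))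

occτ-max-second : ∀ k {u t β} → u < t → All (_< u) β →
  occτ (suc k) (u ∷ t ∷ β) ≡ inc (suc k) β + (inc (suc k) β + occτ (suc k) β)
occτ-max-second k {u} {t} {β} u<t β<u = begin
  occτ (suc k) (u ∷ t ∷ β)
    ≡⟨ occτ-cons (suc k) u (t ∷ β) ⟩
  count (λ s → atMost u s ∧ isIncreasing s) (subseqs (suc k) (t ∷ β)) + occτ (suc k) (t ∷ β)
    ≡⟨ cong₂ _+_ (count-subseqs-cons (λ s → atMost u s ∧ isIncreasing s) k t β) (occτ-cons-max (suc k) β<t) ⟩
  (count (λ s → atMost u (t ∷ s) ∧ isIncreasing (t ∷ s)) (subseqs k β)
     + count (λ s → atMost u s ∧ isIncreasing s) (subseqs (suc k) β)) + (inc (suc k) β + occτ (suc k) β)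
    ≡⟨ cong (_+ (inc (suc k) β + occτ (suc k) β)) (cong₂ _+_
         (count-none (All.universal (λ s → cong (λ b → (not b ∧ atMost u s) ∧ isIncreasing (t ∷ s)) (<ᵇ-true u<t))
                                    (subseqs k β)))
         (count-cong (All.map (λ {s} (s<u , _) → cong (_∧ isIncreasing s) (atMost-true s<u)) (All-subseqs (suc k) β<u)))) ⟩
  inc (suc k) β + (inc (suc k) β + occτ (suc k) β) ∎
  where
  open ≡-Reasoning
  β<t = All.map (λ a<u → <-trans a<u u<t) β<u

occτ-snoc-max : ∀ k {t α} → All (_< t) α → occτ (suc k) (α ++ [ t ]) ≡ occτ (suc k) α
occτ-snoc-max k {t} {α} α<t = trans (occ-snoc (suc (suc k)) (τ-tail (suc k)) α t) (cong (_+ occτ (suc k) α)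
  (count-subseqs-none _ (length (τ-tail (suc k))) α<t no-occurrence))
  where
  no-occurrence : ∀ s → All (_< t) s → length s ≡ length (τ-tail (suc k)) →
                  orderIso (s ++ [ t ]) (tau (suc (suc k))) ≡ false
  no-occurrence (a ∷ s) (a<t ∷ _) len = begin
    orderIso (a ∷ s ++ [ t ]) (tau (suc (suc k)))
      ≡⟨ orderIso-τ (suc k) a (s ++ [ t ])
           (trans (length-++ s) (trans (+-comm (length s) 1) (trans len (τ-tail-length (suc k))))) ⟩
    atMost a (s ++ [ t ]) ∧ isIncreasing (s ++ [ t ])
      ≡⟨ cong (_∧ isIncreasing (s ++ [ t ])) (atMost-false (Any.++⁺ʳ s (here a<t))) ⟩
    false ∎
    where open ≡-Reasoning

∧≡true⇒ʳ : ∀ a {b} → a ∧ b ≡ true → b ≡ true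
∧≡true⇒ʳ true b≡true = b≡true

inc-cons-≤ : ∀ j x xs → inc j xs ≤ inc j (x ∷ xs)
inc-cons-≤ j x xs = count-subseqs-mono (x ∷ʳ ⊆-refl) j isIncreasing

-- Both follow from the fact that an occurrence of τ, or an increasing subsequence of length j + 1,
-- contains an increasing subsequence of length j.
occτ-vanishes : ∀ k π → inc k π ≡ 0 → occτ k π ≡ 0
occτ-vanishes k []       _ = refl
occτ-vanishes k (x ∷ xs) i≡0 rewrite occτ-cons k x xs = cong₂ _+_
  (n≤0⇒n≡0 (≤-trans (count-mono (All.universal (λ s → ∧≡true⇒ʳ (atMost x s)) (subseqs k xs))) inc≤0))
  (occτ-vanishes k xs (n≤0⇒n≡0 inc≤0))
  where inc≤0 = ≤-trans (inc-cons-≤ k x xs) (≤-reflexive i≡0)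

inc-vanishes : ∀ j π → inc j π ≡ 0 → inc (suc j) π ≡ 0
inc-vanishes j []       _ = refl
inc-vanishes j (x ∷ xs) i≡0 rewrite inc-cons j x xs = cong₂ _+_
  (n≤0⇒n≡0 (≤-trans (count-mono (All.universal (λ s → ∧≡true⇒ʳ (allB (map (x <ᵇ_) s))) (subseqs j xs))) inc≤0))
  (inc-vanishes j xs (n≤0⇒n≡0 inc≤0))
  where inc≤0 = ≤-trans (inc-cons-≤ j x xs) (≤-reflexive i≡0)

zeroAndOne : ℕ → ℕ → Bool
zeroAndOne a b = (a ≡ᵇ 0) ∧ (b ≡ᵇ 1)

+≡ᵇ1-dominated : ∀ a b → (a ≡ 0 → b ≡ 0) → ((a + b) ≡ᵇ 1) ≡ zeroAndOne b a
+≡ᵇ1-dominated zero          b b≡0 rewrite b≡0 refl = refl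
+≡ᵇ1-dominated (suc zero)    b _   = sym (∧-identityʳ _)
+≡ᵇ1-dominated (suc (suc a)) b _   = sym (∧-zeroʳ _)

+≡ᵇ1-double : ∀ a b → (a ≡ 0 → b ≡ 0) → ((a + (a + b)) ≡ᵇ 1) ≡ false
+≡ᵇ1-double zero    b b≡0 rewrite b≡0 refl = refl
+≡ᵇ1-double (suc a) b _   rewrite +-suc a (a + b) = refl

zeroAndOne-+ : ∀ a b → zeroAndOne (a + b) a ≡ false
zeroAndOne-+ zero    b = ∧-zeroʳ _
zeroAndOne-+ (suc a) b = refl

zeroAndOne-suc : ∀ a c → (a ≡ 0 → c ≡ 0) → zeroAndOne c (suc a) ≡ (a ≡ᵇ 0)
zeroAndOne-suc zero    c c≡0 rewrite c≡0 refl = refl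
zeroAndOne-suc (suc a) c _   = ∧-zeroʳ _

zeroAndOne-shift : ∀ t p a → (a ≡ 0 → t ≡ 0) → (p ≡ 0 → a ≡ 0) → zeroAndOne t (p + a) ≡ zeroAndOne a p
zeroAndOne-shift t p       zero    t≡0 _   rewrite t≡0 refl | +-identityʳ p = refl
zeroAndOne-shift t zero    (suc a) _   a≡0 = contradiction (a≡0 refl) λ ()
zeroAndOne-shift t (suc p) (suc a) _   _   rewrite +-suc p a = ∧-zeroʳ _

count-𝒫-suc : ∀ (p : List ℕ → Bool) n →
  count p (𝒫 (suc n)) ≡ count (p ∘ (suc n ∷_)) (𝒫 n) + (count p (𝒫MaxSecond n) + count p (𝒫MaxLast n))
count-𝒫-suc p n = trans (count-++ p (map (suc n ∷_) (𝒫 n)) (𝒫MaxSecond n ++ 𝒫MaxLast n))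
  (cong₂ _+_ (count-map p (suc n ∷_) (𝒫 n)) (count-++ p (𝒫MaxSecond n) (𝒫MaxLast n)))

count-𝒫MaxSecond : ∀ (p : List ℕ → Bool) n →
  count p (𝒫MaxSecond (suc n)) ≡ count (λ β → p (suc n ∷ suc (suc n) ∷ β)) (𝒫 n)
count-𝒫MaxSecond p n = count-map p (λ β → suc n ∷ suc (suc n) ∷ β) (𝒫 n)

count-𝒫MaxLast : ∀ (p : List ℕ → Bool) n →
  count p (𝒫MaxLast (suc (suc n))) ≡ count (λ α → p (α ++ [ suc (suc (suc n)) ])) (𝒫 (suc (suc n)))
count-𝒫MaxLast p n = count-map p (_++ [ suc (suc (suc n)) ]) (𝒫 (suc (suc n)))

count-𝒫-cong : ∀ {p q : List ℕ → Bool} n → (∀ {π} → IsPermutation n π → p π ≡ q π) → count p (𝒫 n) ≡ count q (𝒫 n)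
count-𝒫-cong n p≗q = count-cong (All.map (p≗q ∘ proj₁) (𝒫-sound n))

count-𝒫-none : ∀ {p : List ℕ → Bool} n → (∀ {π} → IsPermutation n π → p π ≡ false) → count p (𝒫 n) ≡ 0
count-𝒫-none n never = count-none (All.map (never ∘ proj₁) (𝒫-sound n))

#τ-once : ℕ → ℕ → ℕ
#τ-once k n = count (λ π → occτ k π ≡ᵇ 1) (𝒫 n)

#τ-free-uniqueInc : ℕ → ℕ → ℕ
#τ-free-uniqueInc k n = count (λ π → zeroAndOne (occτ k π) (inc k π)) (𝒫 n)

#uniqueLIS : ℕ → ℕ → ℕ
#uniqueLIS j n = count (λ π → zeroAndOne (inc (suc j) π) (inc j π)) (𝒫 n)

#decreasing : ℕ → ℕ
#decreasing n = count (λ π → inc 2 π ≡ᵇ 0) (𝒫 n)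

inc₂-snoc-max : ∀ {n α} → IsPermutation n α → inc 2 (α ++ [ suc n ]) ≡ n + inc 2 α
inc₂-snoc-max {n} {α} P =
  trans (inc-snoc-max 1 (IsPermutation-< P)) (cong (_+ inc 2 α) (trans (inc-one α) (IsPermutation.length≡ P)))

#decreasing≡1 : ∀ n → #decreasing n ≡ 1
#decreasing≡1 zero    = refl
#decreasing≡1 (suc n) = begin
  #decreasing (suc n)
    ≡⟨ count-𝒫-suc _ n ⟩
  count (λ β → inc 2 (suc n ∷ β) ≡ᵇ 0) (𝒫 n)
    + (count (λ π → inc 2 π ≡ᵇ 0) (𝒫MaxSecond n) + count (λ π → inc 2 π ≡ᵇ 0) (𝒫MaxLast n))
    ≡⟨ cong₂ _+_ (trans (count-𝒫-cong n (λ P → cong (_≡ᵇ 0) (inc-cons-max 0 (IsPermutation-< P)))) (#decreasing≡1 n))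
                 (cong₂ _+_ (max-second n) (max-last n)) ⟩
  1 ∎
  where
  open ≡-Reasoning
  max-second : ∀ n → count (λ π → inc 2 π ≡ᵇ 0) (𝒫MaxSecond n) ≡ 0
  max-second zero    = refl
  max-second (suc m) = trans (count-𝒫MaxSecond _ m)
    (count-𝒫-none m (λ P → cong (_≡ᵇ 0) (inc₂-max-second (n<1+n (suc m)) (IsPermutation-< P))))
  max-last : ∀ n → count (λ π → inc 2 π ≡ᵇ 0) (𝒫MaxLast n) ≡ 0
  max-last zero          = refl
  max-last (suc zero)    = refl
  max-last (suc (suc m)) = trans (count-𝒫MaxLast _ m) (count-𝒫-none (suc (suc m)) (λ P → cong (_≡ᵇ 0) (inc₂-snoc-max P)))

#τ-once-suc : ∀ k n → #τ-once (suc k) (suc n) ≡ #τ-free-uniqueInc (suc k) n + #τ-once (suc k) n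
#τ-once-suc k n = begin
  #τ-once (suc k) (suc n)
    ≡⟨ count-𝒫-suc _ n ⟩
  count (λ β → occτ (suc k) (suc n ∷ β) ≡ᵇ 1) (𝒫 n)
    + (count (λ π → occτ (suc k) π ≡ᵇ 1) (𝒫MaxSecond n) + count (λ π → occτ (suc k) π ≡ᵇ 1) (𝒫MaxLast n))
    ≡⟨ cong₂ _+_ max-first (cong₂ _+_ (max-second n) (max-last n)) ⟩
  #τ-free-uniqueInc (suc k) n + #τ-once (suc k) n ∎
  where
  open ≡-Reasoning
  max-first : count (λ β → occτ (suc k) (suc n ∷ β) ≡ᵇ 1) (𝒫 n) ≡ #τ-free-uniqueInc (suc k) n
  max-first = count-𝒫-cong n λ {β} P →
    trans (cong (_≡ᵇ 1) (occτ-cons-max (suc k) (IsPermutation-< P)))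
          (+≡ᵇ1-dominated (inc (suc k) β) (occτ (suc k) β) (occτ-vanishes (suc k) β))
  max-second : ∀ n → count (λ π → occτ (suc k) π ≡ᵇ 1) (𝒫MaxSecond n) ≡ 0
  max-second zero    = refl
  max-second (suc m) = trans (count-𝒫MaxSecond _ m) (count-𝒫-none m λ {β} P →
    trans (cong (_≡ᵇ 1) (occτ-max-second k (n<1+n (suc m)) (IsPermutation-< P)))
          (+≡ᵇ1-double (inc (suc k) β) (occτ (suc k) β) (occτ-vanishes (suc k) β)))
  max-last : ∀ n → count (λ π → occτ (suc k) π ≡ᵇ 1) (𝒫MaxLast n) ≡ #τ-once (suc k) n
  max-last zero          = refl
  max-last (suc zero)    = refl
  max-last (suc (suc m)) = trans (count-𝒫MaxLast _ m)
    (count-𝒫-cong (suc (suc m)) (λ P → cong (_≡ᵇ 1) (occτ-snoc-max k (IsPermutation-< P))))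

#τ-free-uniqueInc₂ : ∀ n → #τ-free-uniqueInc 2 (suc (suc n)) ≡ 1
#τ-free-uniqueInc₂ n = begin
  #τ-free-uniqueInc 2 (suc (suc n))
    ≡⟨ count-𝒫-suc _ (suc n) ⟩
  count (p ∘ (suc (suc n) ∷_)) (𝒫 (suc n))
    + (count p (𝒫MaxSecond (suc n)) + count p (𝒫MaxLast (suc n)))
    ≡⟨ cong₂ _+_ max-first (cong₂ _+_ max-second (max-last n)) ⟩
  1 ∎
  where
  open ≡-Reasoning
  p : List ℕ → Bool
  p π = zeroAndOne (occτ 2 π) (inc 2 π)
  max-first : count (p ∘ (suc (suc n) ∷_)) (𝒫 (suc n)) ≡ 0
  max-first = count-𝒫-none (suc n) λ {β} P →
    trans (cong₂ zeroAndOne (occτ-cons-max 2 (IsPermutation-< P)) (inc-cons-max 0 (IsPermutation-< P)))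
          (zeroAndOne-+ (inc 2 β) (occτ 2 β))
  max-second : count p (𝒫MaxSecond (suc n)) ≡ 1
  max-second = trans (count-𝒫MaxSecond p n) (trans (count-𝒫-cong n λ {β} P →
    trans (cong₂ zeroAndOne (occτ-max-second 1 (n<1+n (suc n)) (IsPermutation-< P))
                                                (inc₂-max-second (n<1+n (suc n)) (IsPermutation-< P)))
          (zeroAndOne-suc (inc 2 β) (inc 2 β + (inc 2 β + occτ 2 β))
             (λ i≡0 → trans (cong (λ i → i + (i + occτ 2 β)) i≡0) (occτ-vanishes 2 β i≡0))))
    (#decreasing≡1 n))
  max-last : ∀ n → count p (𝒫MaxLast (suc n)) ≡ 0
  max-last zero    = refl
  max-last (suc m) = trans (count-𝒫MaxLast p m) (count-𝒫-none (suc (suc m)) λ {α} P →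
    trans (cong (zeroAndOne (occτ 2 (α ++ [ suc (suc (suc m)) ]))) (inc₂-snoc-max P)) (∧-zeroʳ _))

#τ-free-uniqueInc-suc : ∀ j n → #τ-free-uniqueInc (suc (suc (suc j))) (suc n) ≡ #uniqueLIS (suc (suc j)) n
#τ-free-uniqueInc-suc j n = begin
  #τ-free-uniqueInc K (suc n)
    ≡⟨ count-𝒫-suc p n ⟩
  count (p ∘ (suc n ∷_)) (𝒫 n) + (count p (𝒫MaxSecond n) + count p (𝒫MaxLast n))
    ≡⟨ cong₂ _+_ max-first (cong₂ _+_ (max-second n) (max-last n)) ⟩
  #uniqueLIS (suc (suc j)) n ∎
  where
  open ≡-Reasoning
  K = suc (suc (suc j))
  p : List ℕ → Bool
  p π = zeroAndOne (occτ K π) (inc K π)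
  max-first : count (p ∘ (suc n ∷_)) (𝒫 n) ≡ 0
  max-first = count-𝒫-none n λ {β} P →
    trans (cong₂ zeroAndOne (occτ-cons-max K (IsPermutation-< P)) (inc-cons-max (suc j) (IsPermutation-< P)))
          (zeroAndOne-+ (inc K β) (occτ K β))
  max-second : ∀ n → count p (𝒫MaxSecond n) ≡ 0
  max-second zero    = refl
  max-second (suc m) = trans (count-𝒫MaxSecond p m) (count-𝒫-none m λ {β} P →
    trans (cong₂ zeroAndOne (occτ-max-second (suc (suc j)) (n<1+n (suc m)) (IsPermutation-< P))
                                                (inc-max-second j (n<1+n (suc m)) (IsPermutation-< P)))
          (zeroAndOne-+ (inc K β) (inc K β + occτ K β)))
  max-last : ∀ n → count p (𝒫MaxLast n) ≡ #uniqueLIS (suc (suc j)) n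
  max-last zero          = refl
  max-last (suc zero)    = refl
  max-last (suc (suc m)) = trans (count-𝒫MaxLast p m) (count-𝒫-cong (suc (suc m)) λ {α} P →
    trans (cong₂ zeroAndOne (occτ-snoc-max (suc (suc j)) (IsPermutation-< P)) (inc-snoc-max (suc (suc j)) (IsPermutation-< P)))
          (zeroAndOne-shift (occτ K α) (inc (suc (suc j)) α) (inc K α) (occτ-vanishes K α) (inc-vanishes (suc (suc j)) α)))

#uniqueLIS₂-suc : ∀ n → #uniqueLIS 2 (suc (suc n)) ≡ #uniqueLIS 2 (suc n) + 1
#uniqueLIS₂-suc n = begin
  #uniqueLIS 2 (suc (suc n))
    ≡⟨ count-𝒫-suc p (suc n) ⟩
  count (p ∘ (suc (suc n) ∷_)) (𝒫 (suc n)) + (count p (𝒫MaxSecond (suc n)) + count p (𝒫MaxLast (suc n)))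
    ≡⟨ cong₂ _+_ max-first (cong₂ _+_ max-second (max-last n)) ⟩
  #uniqueLIS 2 (suc n) + 1 ∎
  where
  open ≡-Reasoning
  p : List ℕ → Bool
  p π = zeroAndOne (inc 3 π) (inc 2 π)
  max-first : count (p ∘ (suc (suc n) ∷_)) (𝒫 (suc n)) ≡ #uniqueLIS 2 (suc n)
  max-first = count-𝒫-cong (suc n) λ P →
    cong₂ zeroAndOne (inc-cons-max 1 (IsPermutation-< P)) (inc-cons-max 0 (IsPermutation-< P))
  max-second : count p (𝒫MaxSecond (suc n)) ≡ 1
  max-second = trans (count-𝒫MaxSecond p n) (trans (count-𝒫-cong n λ {β} P →
    trans (cong₂ zeroAndOne (inc-max-second 0 (n<1+n (suc n)) (IsPermutation-< P))
                                                  (inc₂-max-second (n<1+n (suc n)) (IsPermutation-< P)))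
          (zeroAndOne-suc (inc 2 β) (inc 3 β) (inc-vanishes 2 β)))
    (#decreasing≡1 n))
  max-last : ∀ n → count p (𝒫MaxLast (suc n)) ≡ 0
  max-last zero    = refl
  max-last (suc m) = trans (count-𝒫MaxLast p m) (count-𝒫-none (suc (suc m)) λ {α} P →
    trans (cong (zeroAndOne (inc 3 (α ++ [ suc (suc (suc m)) ]))) (inc₂-snoc-max P)) (∧-zeroʳ _))

#uniqueLIS-suc : ∀ j n → #uniqueLIS (suc (suc (suc j))) (suc (suc n))
  ≡ #uniqueLIS (suc (suc (suc j))) (suc n) + (#uniqueLIS (suc (suc (suc j))) n + #uniqueLIS (suc (suc j)) (suc n))
#uniqueLIS-suc j n = begin
  #uniqueLIS J (suc (suc n))
    ≡⟨ count-𝒫-suc p (suc n) ⟩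
  count (p ∘ (suc (suc n) ∷_)) (𝒫 (suc n)) + (count p (𝒫MaxSecond (suc n)) + count p (𝒫MaxLast (suc n)))
    ≡⟨ cong₂ _+_ max-first (cong₂ _+_ max-second (max-last n)) ⟩
  #uniqueLIS J (suc n) + (#uniqueLIS J n + #uniqueLIS (suc (suc j)) (suc n)) ∎
  where
  open ≡-Reasoning
  J = suc (suc (suc j))
  p : List ℕ → Bool
  p π = zeroAndOne (inc (suc J) π) (inc J π)
  max-first : count (p ∘ (suc (suc n) ∷_)) (𝒫 (suc n)) ≡ #uniqueLIS J (suc n)
  max-first = count-𝒫-cong (suc n) λ P →
    cong₂ zeroAndOne (inc-cons-max (suc (suc j)) (IsPermutation-< P)) (inc-cons-max (suc j) (IsPermutation-< P))
  max-second : count p (𝒫MaxSecond (suc n)) ≡ #uniqueLIS J n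
  max-second = trans (count-𝒫MaxSecond p n) (count-𝒫-cong n λ P →
    cong₂ zeroAndOne (inc-max-second (suc j) (n<1+n (suc n)) (IsPermutation-< P))
                                          (inc-max-second j (n<1+n (suc n)) (IsPermutation-< P)))
  max-last : ∀ n → count p (𝒫MaxLast (suc n)) ≡ #uniqueLIS (suc (suc j)) (suc n)
  max-last zero    = refl
  max-last (suc m) = trans (count-𝒫MaxLast p m) (count-𝒫-cong (suc (suc m)) λ {α} P →
    trans (cong₂ zeroAndOne (inc-snoc-max J (IsPermutation-< P)) (inc-snoc-max (suc (suc j)) (IsPermutation-< P)))
          (zeroAndOne-shift (inc J α + inc (suc J) α) (inc (suc (suc j)) α) (inc J α)
             (λ i≡0 → trans (cong (λ i → i + inc (suc J) α) i≡0) (inc-vanishes J α i≡0))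
             (inc-vanishes (suc (suc j)) α)))

shift : (ℕ → ℤ) → ℕ → ℤ
shift f zero    = 0ℤ
shift f (suc n) = f n

infixr 7 _⊛_

_⊛_ : Poly → (ℕ → ℤ) → ℕ → ℤ
([]     ⊛ f) n = 0ℤ
((c ∷ D) ⊛ f) n = c *ℤ f n +ℤ shift (D ⊛ f) n

-- `convCoeff` sums with a helper local to its where-block; the metavariable below is solved by that helper.
mutual
  convCoeffSum : Poly → (ℕ → ℤ) → ℕ → ℕ → ℤ
  convCoeffSum = _

  convCoeff-unfold : ∀ D f m → convCoeff D f (suc m)
                   ≡ coeff D (suc m) *ℤ f (suc m ∸ suc m) +ℤ convCoeffSum D f (suc m) m
  convCoeff-unfold D f m with suc m
  ... | _ = refl

convCoeffSum-[] : ∀ f n k → convCoeffSum [] f n k ≡ 0ℤ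
convCoeffSum-[] f n zero    = refl
convCoeffSum-[] f n (suc k) = cong (0ℤ +ℤ_) (convCoeffSum-[] f n k)

convCoeffSum-∷ : ∀ c D f n k → convCoeffSum (c ∷ D) f (suc n) (suc k) ≡ c *ℤ f (suc n) +ℤ convCoeffSum D f n k
convCoeffSum-∷ c D f n zero    = ℤₚ.+-comm (coeff D 0 *ℤ f n) (c *ℤ f (suc n))
convCoeffSum-∷ c D f n (suc k) =
  trans (cong (coeff D (suc k) *ℤ f (n ∸ suc k) +ℤ_) (convCoeffSum-∷ c D f n k))
        (x∙yz≈y∙xz (coeff D (suc k) *ℤ f (n ∸ suc k)) (c *ℤ f (suc n)) (convCoeffSum D f n k))
  where open CSemigroupProperties ℤₚ.+-commutativeSemigroup using (x∙yz≈y∙xz)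

convCoeffSum≡⊛ : ∀ D f n → convCoeffSum D f n n ≡ (D ⊛ f) n
convCoeffSum≡⊛ []      f n       = convCoeffSum-[] f n n
convCoeffSum≡⊛ (c ∷ D) f zero    = sym (ℤₚ.+-identityʳ _)
convCoeffSum≡⊛ (c ∷ D) f (suc n) = trans (convCoeffSum-∷ c D f n n) (cong (c *ℤ f (suc n) +ℤ_) (convCoeffSum≡⊛ D f n))

convCoeff≡⊛ : ∀ D f n → convCoeff D f n ≡ (D ⊛ f) n
convCoeff≡⊛ = convCoeffSum≡⊛

shift-cong : ∀ {f g} → (∀ m → f m ≡ g m) → ∀ n → shift f n ≡ shift g n
shift-cong f≗g zero    = refl
shift-cong f≗g (suc n) = f≗g n

⊛-cong : ∀ D {f g} → (∀ m → f m ≡ g m) → ∀ n → (D ⊛ f) n ≡ (D ⊛ g) n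
⊛-cong []      f≗g n = refl
⊛-cong (c ∷ D) f≗g n = cong₂ _+ℤ_ (cong (c *ℤ_) (f≗g n)) (shift-cong (⊛-cong D f≗g) n)

⊛-zero : ∀ D n → (D ⊛ (λ _ → 0ℤ)) n ≡ 0ℤ
⊛-zero []      n       = refl
⊛-zero (c ∷ D) zero    = cong (_+ℤ 0ℤ) (ℤₚ.*-zeroʳ c)
⊛-zero (c ∷ D) (suc n) = cong₂ _+ℤ_ (ℤₚ.*-zeroʳ c) (⊛-zero D n)

⊛-+ : ∀ D f g n → (D ⊛ (λ m → f m +ℤ g m)) n ≡ (D ⊛ f) n +ℤ (D ⊛ g) n
⊛-+ []      f g n       = refl
⊛-+ (c ∷ D) f g zero    = lemma c (f 0) (g 0)
  where
  lemma : ∀ c a b → c *ℤ (a +ℤ b) +ℤ 0ℤ ≡ (c *ℤ a +ℤ 0ℤ) +ℤ (c *ℤ b +ℤ 0ℤ)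
  lemma = solve-∀
⊛-+ (c ∷ D) f g (suc n) = trans (cong (c *ℤ (f (suc n) +ℤ g (suc n)) +ℤ_) (⊛-+ D f g n)) (lemma c (f (suc n)) (g (suc n)) _ _)
  where
  lemma : ∀ c a b x y → c *ℤ (a +ℤ b) +ℤ (x +ℤ y) ≡ (c *ℤ a +ℤ x) +ℤ (c *ℤ b +ℤ y)
  lemma = solve-∀

⊛-scale : ∀ D c f n → (D ⊛ (λ m → c *ℤ f m)) n ≡ c *ℤ (D ⊛ f) n
⊛-scale []      c f n       = sym (ℤₚ.*-zeroʳ c)
⊛-scale (d ∷ D) c f zero    = lemma d c (f 0)
  where
  lemma : ∀ d c a → d *ℤ (c *ℤ a) +ℤ 0ℤ ≡ c *ℤ (d *ℤ a +ℤ 0ℤ)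
  lemma = solve-∀
⊛-scale (d ∷ D) c f (suc n) = trans (cong (d *ℤ (c *ℤ f (suc n)) +ℤ_) (⊛-scale D c f n)) (lemma d c (f (suc n)) _)
  where
  lemma : ∀ d c a x → d *ℤ (c *ℤ a) +ℤ c *ℤ x ≡ c *ℤ (d *ℤ a +ℤ x)
  lemma = solve-∀

⊛-shift : ∀ D f n → (D ⊛ shift f) n ≡ shift (D ⊛ f) n
⊛-shift []      f zero    = refl
⊛-shift []      f (suc n) = refl
⊛-shift (c ∷ D) f zero    = cong (_+ℤ 0ℤ) (ℤₚ.*-zeroʳ c)
⊛-shift (c ∷ D) f (suc n) = cong (c *ℤ f n +ℤ_) (⊛-shift D f n)

⊛-comm : ∀ D E f n → (D ⊛ E ⊛ f) n ≡ (E ⊛ D ⊛ f) n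
⊛-comm []      E f n = sym (⊛-zero E n)
⊛-comm (c ∷ D) E f n = sym (begin
  (E ⊛ (λ m → c *ℤ f m +ℤ shift (D ⊛ f) m)) n
    ≡⟨ ⊛-+ E (λ m → c *ℤ f m) (shift (D ⊛ f)) n ⟩
  (E ⊛ (λ m → c *ℤ f m)) n +ℤ (E ⊛ shift (D ⊛ f)) n
    ≡⟨ cong₂ _+ℤ_ (⊛-scale E c f n) (⊛-shift E (D ⊛ f) n) ⟩
  c *ℤ (E ⊛ f) n +ℤ shift (E ⊛ D ⊛ f) n
    ≡⟨ cong (c *ℤ (E ⊛ f) n +ℤ_) (shift-cong (λ m → sym (⊛-comm D E f m)) n) ⟩
  c *ℤ (E ⊛ f) n +ℤ shift (D ⊛ E ⊛ f) n ∎)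
  where open ≡-Reasoning

addP-⊛ : ∀ D E f n → (addP D E ⊛ f) n ≡ (D ⊛ f) n +ℤ (E ⊛ f) n
addP-⊛ []      E       f n       = sym (ℤₚ.+-identityˡ _)
addP-⊛ (d ∷ D) []      f n       = sym (ℤₚ.+-identityʳ _)
addP-⊛ (d ∷ D) (e ∷ E) f zero    = lemma d e (f 0)
  where
  lemma : ∀ d e a → (d +ℤ e) *ℤ a +ℤ 0ℤ ≡ (d *ℤ a +ℤ 0ℤ) +ℤ (e *ℤ a +ℤ 0ℤ)
  lemma = solve-∀
addP-⊛ (d ∷ D) (e ∷ E) f (suc n) =
  trans (cong ((d +ℤ e) *ℤ f (suc n) +ℤ_) (addP-⊛ D E f n)) (lemma d e (f (suc n)) _ _)
  where
  lemma : ∀ d e a x y → (d +ℤ e) *ℤ a +ℤ (x +ℤ y) ≡ (d *ℤ a +ℤ x) +ℤ (e *ℤ a +ℤ y)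
  lemma = solve-∀

scale-⊛ : ∀ c D f n → (map (c *ℤ_) D ⊛ f) n ≡ c *ℤ (D ⊛ f) n
scale-⊛ c []      f n       = sym (ℤₚ.*-zeroʳ c)
scale-⊛ c (d ∷ D) f zero    = lemma c d (f 0)
  where
  lemma : ∀ c d a → c *ℤ d *ℤ a +ℤ 0ℤ ≡ c *ℤ (d *ℤ a +ℤ 0ℤ)
  lemma = solve-∀
scale-⊛ c (d ∷ D) f (suc n) = trans (cong (c *ℤ d *ℤ f (suc n) +ℤ_) (scale-⊛ c D f n)) (lemma c d (f (suc n)) _)
  where
  lemma : ∀ c d a x → c *ℤ d *ℤ a +ℤ c *ℤ x ≡ c *ℤ (d *ℤ a +ℤ x)
  lemma = solve-∀

mulP-⊛ : ∀ D E f n → (mulP D E ⊛ f) n ≡ (D ⊛ E ⊛ f) n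
mulP-⊛ []      E f n = refl
mulP-⊛ (d ∷ D) E f n = begin
  (addP (map (d *ℤ_) E) (0ℤ ∷ mulP D E) ⊛ f) n
    ≡⟨ addP-⊛ (map (d *ℤ_) E) (0ℤ ∷ mulP D E) f n ⟩
  (map (d *ℤ_) E ⊛ f) n +ℤ (0ℤ *ℤ f n +ℤ shift (mulP D E ⊛ f) n)
    ≡⟨ cong₂ _+ℤ_ (scale-⊛ d E f n) (trans (ℤₚ.+-identityˡ _) (shift-cong (mulP-⊛ D E f) n)) ⟩
  d *ℤ (E ⊛ f) n +ℤ shift (D ⊛ E ⊛ f) n ∎
  where open ≡-Reasoning

one-⊛ : ∀ f n → ((ℤ.+ 1 ∷ []) ⊛ f) n ≡ f n
one-⊛ f zero    = trans (ℤₚ.+-identityʳ _) (ℤₚ.*-identityˡ _)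
one-⊛ f (suc n) = trans (ℤₚ.+-identityʳ _) (ℤₚ.*-identityˡ _)

-- Coefficient lists are not normalised, so polynomials are compared by their action on series.
infix 4 _≈ₚ_
record _≈ₚ_ (D E : Poly) : Set where
  constructor mk≈ₚ
  field act : ∀ f n → (D ⊛ f) n ≡ (E ⊛ f) n
open _≈ₚ_

≈ₚ-sym : ∀ {D E} → D ≈ₚ E → E ≈ₚ D
≈ₚ-sym D≈E = mk≈ₚ λ f n → sym (act D≈E f n)

≈ₚ-trans : ∀ {D E F} → D ≈ₚ E → E ≈ₚ F → D ≈ₚ F
≈ₚ-trans D≈E E≈F = mk≈ₚ λ f n → trans (act D≈E f n) (act E≈F f n)

mulP-identityʳ : ∀ D → mulP D (ℤ.+ 1 ∷ []) ≈ₚ D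
mulP-identityʳ D = mk≈ₚ λ f n → trans (mulP-⊛ D (ℤ.+ 1 ∷ []) f n) (⊛-cong D (one-⊛ f) n)

mulP-comm : ∀ D E → mulP D E ≈ₚ mulP E D
mulP-comm D E = mk≈ₚ λ f n → trans (mulP-⊛ D E f n) (trans (⊛-comm D E f n) (sym (mulP-⊛ E D f n)))

mulP-assoc : ∀ D E F → mulP (mulP D E) F ≈ₚ mulP D (mulP E F)
mulP-assoc D E F = mk≈ₚ λ f n → begin
  (mulP (mulP D E) F ⊛ f) n  ≡⟨ mulP-⊛ (mulP D E) F f n ⟩
  (mulP D E ⊛ F ⊛ f) n       ≡⟨ mulP-⊛ D E (F ⊛ f) n ⟩
  (D ⊛ E ⊛ F ⊛ f) n          ≡⟨ ⊛-cong D (mulP-⊛ E F f) n ⟨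
  (D ⊛ mulP E F ⊛ f) n       ≡⟨ mulP-⊛ D (mulP E F) f n ⟨
  (mulP D (mulP E F) ⊛ f) n  ∎
  where open ≡-Reasoning

mulP-congʳ : ∀ D {E E′} → E ≈ₚ E′ → mulP D E ≈ₚ mulP D E′
mulP-congʳ D {E} {E′} E≈E′ = mk≈ₚ λ f n →
  trans (mulP-⊛ D E f n) (trans (⊛-cong D (act E≈E′ f) n) (sym (mulP-⊛ D E′ f n)))

≐-resp-≈ₚ : ∀ {F d D D′} → D ≈ₚ D′ → F ≐x^ d / D → F ≐x^ d / D′
≐-resp-≈ₚ {F} {d} {D} {D′} D≈D′ F≐ n = begin
  convCoeff D′ F n  ≡⟨ convCoeff≡⊛ D′ F n ⟩
  (D′ ⊛ F) n        ≡⟨ act D≈D′ F n ⟨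
  (D ⊛ F) n         ≡⟨ convCoeff≡⊛ D F n ⟨
  convCoeff D F n   ≡⟨ F≐ n ⟩
  monoCoeff d n     ∎
  where open ≡-Reasoning

≐-cong : ∀ {F G d D} → (∀ n → F n ≡ G n) → G ≐x^ d / D → F ≐x^ d / D
≐-cong {F} {G} {d} {D} F≗G G≐ n =
  trans (convCoeff≡⊛ D F n) (trans (⊛-cong D F≗G n) (trans (sym (convCoeff≡⊛ D G n)) (G≐ n)))

shift-monoCoeff : ∀ d n → shift (monoCoeff d) n ≡ monoCoeff (suc d) n
shift-monoCoeff d zero    = refl
shift-monoCoeff d (suc n) = refl

≐-shift : ∀ {F d D} → F ≐x^ d / D → shift F ≐x^ suc d / D
≐-shift {F} {d} {D} F≐ n = begin
  convCoeff D (shift F) n        ≡⟨ convCoeff≡⊛ D (shift F) n ⟩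
  (D ⊛ shift F) n                ≡⟨ ⊛-shift D F n ⟩
  shift (D ⊛ F) n                ≡⟨ shift-cong (λ m → trans (sym (convCoeff≡⊛ D F m)) (F≐ m)) n ⟩
  shift (monoCoeff d) n          ≡⟨ shift-monoCoeff d n ⟩
  monoCoeff (suc d) n            ∎
  where open ≡-Reasoning

≐-divide : ∀ {F G d D} Q → (∀ n → (Q ⊛ F) n ≡ G n) → G ≐x^ d / D → F ≐x^ d / mulP D Q
≐-divide {F} {G} {d} {D} Q QF≗G G≐ n = begin
  convCoeff (mulP D Q) F n  ≡⟨ convCoeff≡⊛ (mulP D Q) F n ⟩
  (mulP D Q ⊛ F) n          ≡⟨ mulP-⊛ D Q F n ⟩
  (D ⊛ Q ⊛ F) n             ≡⟨ ⊛-cong D QF≗G n ⟩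
  (D ⊛ G) n                 ≡⟨ convCoeff≡⊛ D G n ⟨
  convCoeff D G n           ≡⟨ G≐ n ⟩
  monoCoeff d n             ∎
  where open ≡-Reasoning

⊛-constant-one : ∀ D f → ((ℤ.+ 1 ∷ D) ⊛ f) 0 ≡ f 0
⊛-constant-one D f = lemma (f 0)
  where
  lemma : ∀ a → ℤ.+ 1 *ℤ a +ℤ 0ℤ ≡ a
  lemma = solve-∀

⊛-one-minus-x-at-one : ∀ D f → ((ℤ.+ 1 ∷ - ℤ.+ 1 ∷ D) ⊛ f) 1 ≡ f 1 -ℤ f 0
⊛-one-minus-x-at-one D f = lemma (f 1) (f 0)
  where
  lemma : ∀ a b → ℤ.+ 1 *ℤ a +ℤ (- ℤ.+ 1 *ℤ b +ℤ 0ℤ) ≡ a -ℤ b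
  lemma = solve-∀

oneMinusX-⊛-suc : ∀ f n → (oneMinusX ⊛ f) (suc n) ≡ f (suc n) -ℤ f n
oneMinusX-⊛-suc f n = trans (cong (λ z → ℤ.+ 1 *ℤ f (suc n) +ℤ (- ℤ.+ 1 *ℤ f n +ℤ z)) (shift-zero n)) (lemma (f (suc n)) (f n))
  where
  shift-zero : ∀ n → shift (λ _ → 0ℤ) n ≡ 0ℤ
  shift-zero zero    = refl
  shift-zero (suc n) = refl
  lemma : ∀ a b → ℤ.+ 1 *ℤ a +ℤ (- ℤ.+ 1 *ℤ b +ℤ 0ℤ) ≡ a -ℤ b
  lemma = solve-∀

oneMinusXMinusX²-⊛-suc-suc : ∀ f n → (oneMinusXMinusX² ⊛ f) (suc (suc n)) ≡ f (suc (suc n)) -ℤ f (suc n) -ℤ f n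
oneMinusXMinusX²-⊛-suc-suc f n =
  trans (cong (λ z → ℤ.+ 1 *ℤ f (suc (suc n)) +ℤ (- ℤ.+ 1 *ℤ f (suc n) +ℤ (- ℤ.+ 1 *ℤ f n +ℤ z))) (shift-zero n))
        (lemma (f (suc (suc n))) (f (suc n)) (f n))
  where
  shift-zero : ∀ n → shift (λ _ → 0ℤ) n ≡ 0ℤ
  shift-zero zero    = refl
  shift-zero (suc n) = refl
  lemma : ∀ a b c → ℤ.+ 1 *ℤ a +ℤ (- ℤ.+ 1 *ℤ b +ℤ (- ℤ.+ 1 *ℤ c +ℤ 0ℤ)) ≡ a -ℤ b -ℤ c
  lemma = solve-∀

+-difference : ∀ {a b c} → a ≡ c + b → ℤ.+ a -ℤ ℤ.+ b ≡ ℤ.+ c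
+-difference {b = b} {c} refl = trans (ℤₚ.m-n≡m⊖n (c + b) b) (trans (ℤₚ.⊖-≥ (m≤n+m b c)) (cong ℤ.+_ (m+n∸n≡m c b)))

+-difference₂ : ∀ {a b c d} → a ≡ b + (c + d) → ℤ.+ a -ℤ ℤ.+ b -ℤ ℤ.+ c ≡ ℤ.+ d
+-difference₂ {b = b} {c} {d} refl = lemma (ℤ.+ b) (ℤ.+ c) (ℤ.+ d)
  where
  lemma : ∀ x y z → (x +ℤ (y +ℤ z)) -ℤ x -ℤ y ≡ z
  lemma = solve-∀

atLeastTwo : ℕ → ℤ
atLeastTwo zero          = 0ℤ
atLeastTwo (suc zero)    = 0ℤ
atLeastTwo (suc (suc n)) = ℤ.+ 1

atLeastTwo-≐ : atLeastTwo ≐x^ 2 / oneMinusX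
atLeastTwo-≐ n = trans (convCoeff≡⊛ oneMinusX atLeastTwo n) (steps n)
  where
  steps : ∀ n → (oneMinusX ⊛ atLeastTwo) n ≡ monoCoeff 2 n
  steps zero                = ⊛-constant-one (- ℤ.+ 1 ∷ []) atLeastTwo
  steps (suc zero)          = oneMinusX-⊛-suc atLeastTwo 0
  steps (suc (suc zero))    = oneMinusX-⊛-suc atLeastTwo 1
  steps (suc (suc (suc n))) = oneMinusX-⊛-suc atLeastTwo (suc (suc n))

denominatorE : ℕ → Poly
denominatorE j = mulP (powP oneMinusX 2) (powP oneMinusXMinusX² j)

E : ℕ → ℕ → ℤ
E j n = ℤ.+ #uniqueLIS j n

E₂-step : ∀ n → (oneMinusX ⊛ E 2) n ≡ atLeastTwo n
E₂-step zero          = ⊛-constant-one (- ℤ.+ 1 ∷ []) (E 2)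
E₂-step (suc zero)    = oneMinusX-⊛-suc (E 2) 0
E₂-step (suc (suc n)) = trans (oneMinusX-⊛-suc (E 2) (suc n))
  (+-difference {b = #uniqueLIS 2 (suc n)} (trans (#uniqueLIS₂-suc n) (+-comm _ 1)))

E-step : ∀ j n → (oneMinusXMinusX² ⊛ E (suc (suc (suc j)))) n ≡ shift (E (suc (suc j))) n
E-step j zero          = ⊛-constant-one (- ℤ.+ 1 ∷ - ℤ.+ 1 ∷ []) (E (suc (suc (suc j))))
E-step j (suc zero)    = ⊛-one-minus-x-at-one (- ℤ.+ 1 ∷ []) (E (suc (suc (suc j))))
E-step j (suc (suc n)) = trans (oneMinusXMinusX²-⊛-suc-suc (E (suc (suc (suc j)))) n)
  (+-difference₂ {b = #uniqueLIS (suc (suc (suc j))) (suc n)} {c = #uniqueLIS (suc (suc (suc j))) n} (#uniqueLIS-suc j n))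

E-≐ : ∀ j → E (suc (suc j)) ≐x^ suc (suc j) / denominatorE j
E-≐ zero    = ≐-resp-≈ₚ
  (≈ₚ-sym (≈ₚ-trans (mulP-identityʳ (powP oneMinusX 2)) (mulP-congʳ oneMinusX (mulP-identityʳ oneMinusX))))
  (≐-divide oneMinusX E₂-step atLeastTwo-≐)
E-≐ (suc j) = ≐-resp-≈ₚ
  (≈ₚ-trans (mulP-assoc (powP oneMinusX 2) (powP oneMinusXMinusX² j) oneMinusXMinusX²)
            (mulP-congʳ (powP oneMinusX 2) (mulP-comm (powP oneMinusXMinusX² j) oneMinusXMinusX²)))
  (≐-divide oneMinusXMinusX² (E-step j) (≐-shift (E-≐ j)))

B C : ℕ → ℕ → ℤ
B k n = ℤ.+ #τ-once k n
C k n = ℤ.+ #τ-free-uniqueInc k n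

B-step : ∀ k n → (oneMinusX ⊛ B (suc k)) n ≡ shift (C (suc k)) n
B-step k zero    = ⊛-constant-one (- ℤ.+ 1 ∷ []) (B (suc k))
B-step k (suc n) = trans (oneMinusX-⊛-suc (B (suc k)) n) (+-difference {b = #τ-once (suc k) n} (#τ-once-suc k n))

C₂≗atLeastTwo : ∀ n → C 2 n ≡ atLeastTwo n
C₂≗atLeastTwo zero          = refl
C₂≗atLeastTwo (suc zero)    = refl
C₂≗atLeastTwo (suc (suc n)) = cong ℤ.+_ (#τ-free-uniqueInc₂ n)

C≗shift-E : ∀ j n → C (suc (suc (suc j))) n ≡ shift (E (suc (suc j))) n
C≗shift-E j zero    = refl
C≗shift-E j (suc n) = cong ℤ.+_ (#τ-free-uniqueInc-suc j n)

B¹≗B : ∀ k n → B¹ (tau (suc k)) n ≡ B k n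
B¹≗B k n = cong ℤ.+_ (count-P132 (λ π → occτ k π ≡ᵇ 1) n)

B¹-312 : B¹ (3 ∷ 1 ∷ 2 ∷ []) ≐x^ 3 / powP oneMinusX 2
B¹-312 = ≐-cong (B¹≗B 2) (≐-resp-≈ₚ (mulP-congʳ oneMinusX (≈ₚ-sym (mulP-identityʳ oneMinusX)))
  (≐-divide oneMinusX (B-step 1) (≐-shift (≐-cong C₂≗atLeastTwo atLeastTwo-≐))))

B¹-τ : ∀ j → B¹ (tau (suc (suc (suc (suc j)))))
              ≐x^ suc (suc (suc (suc j))) / mulP (powP oneMinusX 3) (powP oneMinusXMinusX² j)
B¹-τ j = ≐-cong (B¹≗B (suc (suc (suc j)))) (≐-resp-≈ₚ
  (≈ₚ-sym (≈ₚ-trans (mulP-assoc oneMinusX (powP oneMinusX 2) (powP oneMinusXMinusX² j))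
                     (mulP-comm oneMinusX (denominatorE j))))
  (≐-divide oneMinusX (B-step (suc (suc j))) (≐-shift (≐-cong (C≗shift-E j) (≐-shift (E-≐ j))))))

mainTheorem16 : (B¹ (3 ∷ 1 ∷ 2 ∷ []) ≐x^ 3 / powP oneMinusX 2)
    × (∀ (d : ℕ) → 4 ≤ d →
        B¹ (tau d) ≐x^ d / mulP (powP oneMinusX 3) (powP oneMinusXMinusX² (d ∸ 4)))
mainTheorem16 = B¹-312 , λ { .(suc (suc (suc (suc j)))) (s≤s (s≤s (s≤s (s≤s {n = j} _)))) → B¹-τ j }
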